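{- Let $p \geq 5$ be prime and $A \subseteq \mathbb{Z}_p^2$ with $|A| = 2p+1$. Let $H$ be a subgroup of $\mathbb{Z}_p^2$ of order $p$, with cosets indexed $H_0 = H, H_1, \dots, H_{p-1}$ so that $H_i + H_j = H_{i+j}$ (indices mod $p$), and put $A_i = A \cap H_i$. Assume $|A_0| \geq |A_i|$ for all $i$, and that $|A_0| \geq \frac{p+3}{2}$. Then $|\hat{2}A| \geq 4p$, where $\hat{2}A = \{a_1+a_2 \mid a_1,a_2 \in A, a_1 \neq a_2\}$. -}

module Defs where

open import Data.Nat using (ℕ; NonZero)
open import Data.Nat.DivMod using (_mod_)
open import Data.Fin as F using (Fin; toℕ)
open import Data.Product using (_×_; _,_)
open import Data.Product.Properties using (≡-dec)
open import Data.List using (List; filter; concatMap; map; deduplicate; length)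
open import Relation.Nullary using (¬?)
open import Relation.Binary.PropositionalEquality using (_≡_)
open import Relation.Binary.Definitions using (DecidableEquality)
import Data.Nat as N

infixl 6 _+ₚ_
_+ₚ_ : {p : ℕ} .{{_ : NonZero p}} → Fin p → Fin p → Fin p
_+ₚ_ {p} a b = (toℕ a N.+ toℕ b) mod p

-ₚ_ : {p : ℕ} .{{_ : NonZero p}} → Fin p → Fin p
-ₚ_ {p} a = (p N.∸ toℕ a) mod p

0ₚ : {p : ℕ} .{{_ : NonZero p}} → Fin p
0ₚ {p} = 0 mod p

G : ℕ → Set
G p = Fin p × Fin p

infixl 6 _⊕_
_⊕_ : {p : ℕ} .{{_ : NonZero p}} → G p → G p → G p
(a , b) ⊕ (c , d) = (a +ₚ c , b +ₚ d)

⊖_ : {p : ℕ} .{{_ : NonZero p}} → G p → G p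
⊖ (a , b) = (-ₚ a , -ₚ b)

𝟘 : {p : ℕ} .{{_ : NonZero p}} → G p
𝟘 = (0ₚ , 0ₚ)

_≟G_ : {p : ℕ} → DecidableEquality (G p)
_≟G_ = ≡-dec F._≟_ F._≟_

restrictedSumset : {p : ℕ} .{{_ : NonZero p}} → List (G p) → List (G p)
restrictedSumset A =
  deduplicate _≟G_
    (concatMap (λ a₁ → map (λ a₂ → a₁ ⊕ a₂) (filter (λ a₂ → ¬? (a₁ ≟G a₂)) A)) A)

-- A_i = A ∩ H_i where H_i = idx⁻¹(i)
slice : {p : ℕ} → (G p → Fin p) → List (G p) → Fin p → List (G p)
slice idx A i = filter (λ a → idx a F.≟ i) A

-- Write A_i = A ∩ H_i and f_i = |2^A ∩ H_i|, so that |2^A| ≥ Σ f_i.  As 2|A_0| ≥ p + 3, each element of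
-- H_0 = H_0 + H_0 has at least two representations by elements of A_0, at most one of them a double, so
-- f_0 = p.  For every other coset meeting A, Cauchy–Davenport in ℤ_p², proved by Dyson's e-transform
-- since every nonzero element has order p, gives f_c ≥ |A_0 + A_c| ≥ min(p, |A_0| + |A_c| - 1).  The
-- |A_c| with c ≠ 0 add up to at least p + 1, and a case analysis on the number of such cosets, using the
-- cosets of pairwise sums (or of doubles, together with a weak Erdős–Heilbronn bound, when the two
-- cosets are opposite), finds 3p further restricted sums.

module Submission where

open import Defs
open import Algebra.Bundles using (AbelianGroup)
open import Algebra.Consequences.Propositional using (comm∧assoc⇒middleFour; comm∧idʳ⇒id; comm∧invʳ⇒inv)
open import Algebra.Core using (Op₁; Op₂)
open import Algebra.Structures using (IsAbelianGroup)
import Algebra.Properties.AbelianGroup as AbelianGroupProperties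
import Algebra.Properties.Monoid.Mult as MonoidMultiplication
open import Data.Bool using (Bool; true; false; T; _∧_; _∨_; not)
open import Data.Bool.Properties using (T-∧; T-∨; T-not-≡; ∧-comm)
open import Data.Empty using (⊥; ⊥-elim)
open import Data.Fin as Fin using (Fin; toℕ)
open import Data.Fin.Properties using (toℕ-injective; toℕ<n; toℕ-fromℕ<)
open import Data.List using (List; []; _∷_; _++_; length; map; filter; filterᵇ; tabulate; allFin; cartesianProduct)
open import Data.List.Properties using (length-++; length-map; length-tabulate)
open import Data.List.Membership.Propositional using (_∈_; find; lose)
open import Data.List.Membership.Propositional.Properties
  using (∈-filter⁺; ∈-filter⁻; ∈-∃++; ∈-++⁻; ∈-++⁺ˡ; ∈-++⁺ʳ; ∈-map⁺; ∈-map⁻; ∈-tabulate⁻; ∈-allFin;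
         ∈-cartesianProduct⁺; ∈-concatMap⁺; ∈-deduplicate⁺)
import Data.List.Membership.DecPropositional as DecMembership
open import Data.List.Relation.Binary.Permutation.Propositional
  using (_↭_; ↭-refl; ↭-prep; ↭-swap; ↭-trans; ↭-sym; ↭⇒↭ₛ)
open import Data.List.Relation.Binary.Permutation.Propositional.Properties using (All-resp-↭; map⁺)
import Data.List.Relation.Binary.Permutation.Setoid.Properties as PermutationSetoid
open import Data.List.Relation.Unary.All as All using (All)
import Data.List.Relation.Unary.AllPairs as AllPairs
open import Data.List.Relation.Unary.Any using (here; there; any?)
open import Data.List.Relation.Unary.Unique.Propositional using (Unique)
import Data.List.Relation.Unary.Unique.Propositional.Properties as Unique
open import Data.Nat using (ℕ; zero; suc; NonZero; >-nonZero; >-nonZero⁻¹; _+_; _*_; _∸_; _%_; _≤_; _<_; z≤n; s≤s; s≤s⁻¹; _≤?_)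
open import Data.Nat.DivMod using (%-distribˡ-+; m%n%n≡m%n; m<n⇒m%n≡m; n%n≡0)
open import Data.Nat.Divisibility using (_∣_; m%n≡0⇒n∣m; ∣⇒≤)
open import Data.Nat.Induction using (<-rec)
open import Data.Nat.ListAction using (sum)
open import Data.Nat.ListAction.Properties using (sum-↭)
open import Data.Nat.Primality using (Prime; euclidsLemma)
open import Data.Nat.Properties hiding (_≟_)
open import Data.Nat.Tactic.RingSolver using (solve; solve-∀)
open import Data.Product using (_×_; _,_; proj₁; proj₂; ∃; ∃₂)
open import Data.Product.Properties using (≡-dec; ,-injectiveˡ; ,-injectiveʳ)
open import Data.Sum as Sum using (_⊎_; inj₁; inj₂)
open import Function using (_∘_)
open import Function.Bundles using (_⇔_; Equivalence)
open import Level using (0ℓ)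
open import Relation.Binary.Definitions using (DecidableEquality; tri<; tri≈; tri>)
open import Relation.Binary.PropositionalEquality
open import Relation.Binary.PropositionalEquality.Algebra using (isMagma)
open import Relation.Nullary using (¬_; ¬?; Dec; yes; no; _×-dec_; contradiction)
open import Relation.Nullary.Decidable as Dec using (T?; ⌊_⌋; fromWitness; toWitness; decidable-stable)
open import Relation.Unary using (Decidable)

module _ {A : Set} where
  open AllPairs using (_∷_)

  length-≤-⊆ : ∀ {xs ys : List A} → Unique xs → (∀ {x} → x ∈ xs → x ∈ ys) →
               length xs ≤ length ys
  length-≤-⊆ {xs = []} _ _ = z≤n
  length-≤-⊆ {xs = x ∷ xs} {ys} (x∉xs ∷ xs!) xs⊆ys with ∈-∃++ (xs⊆ys (here refl))
  ... | us , vs , refl = begin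
    suc (length xs)          ≤⟨ s≤s (length-≤-⊆ xs! xs⊆us++vs) ⟩
    suc (length (us ++ vs))  ≡⟨ cong suc (length-++ us) ⟩
    suc (length us + length vs) ≡⟨ +-suc (length us) (length vs) ⟨
    length us + suc (length vs) ≡⟨ length-++ us ⟨
    length (us ++ x ∷ vs)    ∎
    where
    open ≤-Reasoning
    xs⊆us++vs : ∀ {y} → y ∈ xs → y ∈ us ++ vs
    xs⊆us++vs {y} y∈xs with ∈-++⁻ us (xs⊆ys (there y∈xs))
    ... | inj₁ y∈us          = ∈-++⁺ˡ y∈us
    ... | inj₂ (here refl)   = ⊥-elim (All.lookup x∉xs y∈xs refl)
    ... | inj₂ (there y∈vs)  = ∈-++⁺ʳ us y∈vs

sum-map-mono : ∀ {A : Set} {f g : A → ℕ} {xs} → (∀ {x} → x ∈ xs → f x ≤ g x) → sum (map f xs) ≤ sum (map g xs)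
sum-map-mono {xs = []} f≤g = z≤n
sum-map-mono {xs = x ∷ xs} f≤g = +-mono-≤ (f≤g (here refl)) (sum-map-mono (f≤g ∘ there))

module FiniteSubsets {A : Set} (_≟_ : DecidableEquality A)
  (elements : List A) (∈-elements : ∀ x → x ∈ elements) (elements-unique : Unique elements) where

  open AllPairs using ([]; _∷_)

  Subset : Set
  Subset = A → Bool

  infix 4 _∈ₛ_ _⊆_
  record _∈ₛ_ (x : A) (X : Subset) : Set where
    constructor ∈ₛ⁺
    field ∈ₛ⁻ : T (X x)
  open _∈ₛ_ public

  _⊆_ : Subset → Subset → Set
  X ⊆ Y = ∀ {x} → x ∈ₛ X → x ∈ₛ Y

  infixr 7 _∩_ _∖_
  infixr 6 _∪_
  _∩_ _∪_ _∖_ : Subset → Subset → Subset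
  (X ∩ Y) x = X x ∧ Y x
  (X ∪ Y) x = X x ∨ Y x
  (X ∖ Y) x = X x ∧ not (Y x)

  ｛_｝ : A → Subset
  ｛ x ｝ y = ⌊ x ≟ y ⌋

  ∩⁺ : ∀ {X Y x} → x ∈ₛ X → x ∈ₛ Y → x ∈ₛ X ∩ Y
  ∩⁺ (∈ₛ⁺ x∈X) (∈ₛ⁺ x∈Y) = ∈ₛ⁺ (Equivalence.from T-∧ (x∈X , x∈Y))

  ∩⁻ : ∀ {X Y x} → x ∈ₛ X ∩ Y → x ∈ₛ X × x ∈ₛ Y
  ∩⁻ (∈ₛ⁺ x∈X∩Y) = let (x∈X , x∈Y) = Equivalence.to T-∧ x∈X∩Y in ∈ₛ⁺ x∈X , ∈ₛ⁺ x∈Y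

  ∪⁺ˡ : ∀ {X Y x} → x ∈ₛ X → x ∈ₛ X ∪ Y
  ∪⁺ˡ (∈ₛ⁺ x∈X) = ∈ₛ⁺ (Equivalence.from T-∨ (inj₁ x∈X))

  ∪⁺ʳ : ∀ {X Y x} → x ∈ₛ Y → x ∈ₛ X ∪ Y
  ∪⁺ʳ (∈ₛ⁺ x∈Y) = ∈ₛ⁺ (Equivalence.from T-∨ (inj₂ x∈Y))

  ∪⁻ : ∀ {X Y x} → x ∈ₛ X ∪ Y → x ∈ₛ X ⊎ x ∈ₛ Y
  ∪⁻ (∈ₛ⁺ x∈X∪Y) = Sum.map ∈ₛ⁺ ∈ₛ⁺ (Equivalence.to T-∨ x∈X∪Y)

  ∖⁺ : ∀ {X Y x} → x ∈ₛ X → ¬ x ∈ₛ Y → x ∈ₛ X ∖ Y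
  ∖⁺ {X} {Y} {x} x∈X x∉Y with Y x in eq
  ... | true  = ⊥-elim (x∉Y (∈ₛ⁺ (subst T (sym eq) _)))
  ... | false = ∈ₛ⁺ (Equivalence.from T-∧ (∈ₛ⁻ x∈X , subst (T ∘ not) (sym eq) _))

  ∖⁻ : ∀ {X Y x} → x ∈ₛ X ∖ Y → x ∈ₛ X × ¬ x ∈ₛ Y
  ∖⁻ {X} {Y} {x} (∈ₛ⁺ x∈X∖Y) =
    let (x∈X , x∉Y) = Equivalence.to T-∧ x∈X∖Y
    in ∈ₛ⁺ x∈X , λ (∈ₛ⁺ x∈Y) → subst T (Equivalence.to T-not-≡ x∉Y) x∈Y

  ∈｛｝ : ∀ x → x ∈ₛ ｛ x ｝
  ∈｛｝ x = ∈ₛ⁺ (fromWitness {a? = x ≟ x} refl)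

  ∈｛｝⁻ : ∀ {x y} → y ∈ₛ ｛ x ｝ → x ≡ y
  ∈｛｝⁻ {x} {y} (∈ₛ⁺ y∈｛x｝) = toWitness {a? = x ≟ y} y∈｛x｝

  ∣_∣ : Subset → ℕ
  ∣ X ∣ = length (filterᵇ X elements)

  private
    count : Subset → List A → ℕ
    count X xs = length (filterᵇ X xs)

    count-mono : ∀ {X Y} xs → X ⊆ Y → count X xs ≤ count Y xs
    count-mono [] X⊆Y = z≤n
    count-mono {X} {Y} (x ∷ xs) X⊆Y with X x in eqX | Y x in eqY
    ... | true  | true  = s≤s (count-mono xs X⊆Y)
    ... | false | true  = m≤n⇒m≤1+n (count-mono xs X⊆Y)
    ... | false | false = count-mono xs X⊆Y
    ... | true  | false with () ← subst T eqY (∈ₛ⁻ (X⊆Y (∈ₛ⁺ (subst T (sym eqX) _))))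

    count-∪-∩ : ∀ X Y xs → count (X ∪ Y) xs + count (X ∩ Y) xs ≡ count X xs + count Y xs
    count-∪-∩ X Y [] = refl
    count-∪-∩ X Y (x ∷ xs) with X x | Y x
    ... | true  | true  = cong suc (trans (+-suc _ _) (trans (cong suc (count-∪-∩ X Y xs)) (sym (+-suc _ _))))
    ... | true  | false = cong suc (count-∪-∩ X Y xs)
    ... | false | true  = trans (cong suc (count-∪-∩ X Y xs)) (sym (+-suc _ _))
    ... | false | false = count-∪-∩ X Y xs

    count-∩-∖ : ∀ X Y xs → count X xs ≡ count (X ∩ Y) xs + count (X ∖ Y) xs
    count-∩-∖ X Y [] = refl
    count-∩-∖ X Y (x ∷ xs) with X x | Y x
    ... | true  | true  = cong suc (count-∩-∖ X Y xs)
    ... | true  | false = trans (cong suc (count-∩-∖ X Y xs)) (sym (+-suc _ _))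
    ... | false | _     = count-∩-∖ X Y xs

  ∣∣-mono : ∀ {X Y} → X ⊆ Y → ∣ X ∣ ≤ ∣ Y ∣
  ∣∣-mono = count-mono elements

  ∣∪∣+∣∩∣ : ∀ X Y → ∣ X ∪ Y ∣ + ∣ X ∩ Y ∣ ≡ ∣ X ∣ + ∣ Y ∣
  ∣∪∣+∣∩∣ X Y = count-∪-∩ X Y elements

  ∣∣≡∣∩∣+∣∖∣ : ∀ X Y → ∣ X ∣ ≡ ∣ X ∩ Y ∣ + ∣ X ∖ Y ∣
  ∣∣≡∣∩∣+∣∖∣ X Y = count-∩-∖ X Y elements

  ∣∣-cong : ∀ {X Y} → (∀ x → X x ≡ Y x) → ∣ X ∣ ≡ ∣ Y ∣
  ∣∣-cong X≗Y = ≤-antisym (∣∣-mono (λ {x} (∈ₛ⁺ x∈X) → ∈ₛ⁺ (subst T (X≗Y x) x∈X)))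
                         (∣∣-mono (λ {x} (∈ₛ⁺ x∈Y) → ∈ₛ⁺ (subst T (sym (X≗Y x)) x∈Y)))

  length≤∣∣ : ∀ {X ys} → Unique ys → (∀ {y} → y ∈ ys → y ∈ₛ X) → length ys ≤ ∣ X ∣
  length≤∣∣ {X} ys! ys⊆X = length-≤-⊆ ys! (λ {y} y∈ys → ∈-filter⁺ (T? ∘ X) (∈-elements y) (∈ₛ⁻ (ys⊆X y∈ys)))

  ∣∣≤length : ∀ {X ys} → (∀ {x} → x ∈ₛ X → x ∈ ys) → ∣ X ∣ ≤ length ys
  ∣∣≤length {X} X⊆ys = length-≤-⊆ (Unique.filter⁺ (T? ∘ X) elements-unique)
    (λ x∈X → X⊆ys (∈ₛ⁺ (proj₂ (∈-filter⁻ (T? ∘ X) {xs = elements} x∈X))))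

  ∣∣-injection : ∀ {X Y} (f : A → A) → (∀ {x y} → f x ≡ f y → x ≡ y) →
                 (∀ {x} → x ∈ₛ X → f x ∈ₛ Y) → ∣ X ∣ ≤ ∣ Y ∣
  ∣∣-injection {X} {Y} f f-injective f[X]⊆Y = begin
    ∣ X ∣                             ≡⟨ length-map f (filterᵇ X elements) ⟨
    length (map f (filterᵇ X elements)) ≤⟨ length≤∣∣ (Unique.map⁺ f-injective (Unique.filter⁺ (T? ∘ X) elements-unique)) f[X]⊆Y′ ⟩
    ∣ Y ∣                             ∎
    where
    open ≤-Reasoning
    f[X]⊆Y′ : ∀ {y} → y ∈ map f (filterᵇ X elements) → y ∈ₛ Y
    f[X]⊆Y′ y∈f[X] with ∈-map⁻ f y∈f[X]
    ... | x , x∈X , refl = f[X]⊆Y (∈ₛ⁺ (proj₂ (∈-filter⁻ (T? ∘ X) {xs = elements} x∈X)))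

  ∣∣-∘-inverse : ∀ X (f g : A → A) → (∀ x → f (g x) ≡ x) → (∀ x → g (f x) ≡ x) → ∣ X ∘ f ∣ ≡ ∣ X ∣
  ∣∣-∘-inverse X f g fg≗id gf≗id = ≤-antisym
    (∣∣-injection f (λ {x} {y} fx≡fy → trans (sym (gf≗id x)) (trans (cong g fx≡fy) (gf≗id y))) (λ (∈ₛ⁺ x∈X∘f) → ∈ₛ⁺ x∈X∘f))
    (∣∣-injection g (λ {x} {y} gx≡gy → trans (sym (fg≗id x)) (trans (cong f gx≡gy) (fg≗id y)))
                    (λ {x} x∈X → ∈ₛ⁺ (∈ₛ⁻ (subst (_∈ₛ X) (sym (fg≗id x)) x∈X))))

  nonempty : ∀ {X} → 0 < ∣ X ∣ → ∃ (_∈ₛ X)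
  nonempty {X} 0<∣X∣ with filterᵇ X elements in eq
  ... | x ∷ _ = x , ∈ₛ⁺ (proj₂ (∈-filter⁻ (T? ∘ X) {xs = elements} (subst (x ∈_) (sym eq) (here refl))))

  ∣∣-pos : ∀ {X x} → x ∈ₛ X → 0 < ∣ X ∣
  ∣∣-pos {X} {x} x∈X = length≤∣∣ {X} {x ∷ []} (All.[] ∷ []) (λ { (here refl) → x∈X })

  ∣∣≤1+∣∖｛｝∣ : ∀ X x → ∣ X ∣ ≤ suc ∣ X ∖ ｛ x ｝ ∣
  ∣∣≤1+∣∖｛｝∣ X x = begin
    ∣ X ∣                                  ≡⟨ ∣∣≡∣∩∣+∣∖∣ X ｛ x ｝ ⟩
    ∣ X ∩ ｛ x ｝ ∣ + ∣ X ∖ ｛ x ｝ ∣       ≤⟨ +-monoˡ-≤ _ ∣X∩｛x｝∣≤1 ⟩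
    suc ∣ X ∖ ｛ x ｝ ∣                    ∎
    where
    open ≤-Reasoning
    ∣X∩｛x｝∣≤1 : ∣ X ∩ ｛ x ｝ ∣ ≤ 1
    ∣X∩｛x｝∣≤1 = ∣∣≤length {ys = x ∷ []} (λ y∈X∩｛x｝ → here (sym (∈｛｝⁻ (proj₂ (∩⁻ {X} y∈X∩｛x｝)))))

  another : ∀ {X} x → 2 ≤ ∣ X ∣ → ∃ λ y → y ∈ₛ X × y ≢ x
  another {X} x 2≤∣X∣ with nonempty {X ∖ ｛ x ｝} (s≤s⁻¹ (≤-trans 2≤∣X∣ (∣∣≤1+∣∖｛｝∣ X x)))
  ... | y , y∈X∖｛x｝ = y , proj₁ (∖⁻ {X} y∈X∖｛x｝) , λ y≡x → proj₂ (∖⁻ {X} y∈X∖｛x｝) (subst (_∈ₛ ｛ x ｝) (sym y≡x) (∈｛｝ x))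

  ∣∣-strict : ∀ {X Y x} → X ⊆ Y → x ∈ₛ Y → ¬ x ∈ₛ X → suc ∣ X ∣ ≤ ∣ Y ∣
  ∣∣-strict {X} {Y} {x} X⊆Y x∈Y x∉X = begin
    suc ∣ X ∣                                ≡⟨ +-comm 1 ∣ X ∣ ⟩
    ∣ X ∣ + 1                                ≤⟨ +-monoʳ-≤ ∣ X ∣ (∣∣-pos {｛ x ｝} (∈｛｝ x)) ⟩
    ∣ X ∣ + ∣ ｛ x ｝ ∣                      ≡⟨ ∣∪∣+∣∩∣ X ｛ x ｝ ⟨
    ∣ X ∪ ｛ x ｝ ∣ + ∣ X ∩ ｛ x ｝ ∣         ≤⟨ +-mono-≤ (∣∣-mono X∪｛x｝⊆Y) (∣∣≤length {ys = []} X∩｛x｝⊆∅) ⟩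
    ∣ Y ∣ + 0                                ≡⟨ +-identityʳ ∣ Y ∣ ⟩
    ∣ Y ∣                                    ∎
    where
    open ≤-Reasoning
    X∪｛x｝⊆Y : X ∪ ｛ x ｝ ⊆ Y
    X∪｛x｝⊆Y {y} y∈ with ∪⁻ {X} y∈
    ... | inj₁ y∈X = X⊆Y y∈X
    ... | inj₂ y∈｛x｝ = subst (_∈ₛ Y) (∈｛｝⁻ y∈｛x｝) x∈Y
    X∩｛x｝⊆∅ : ∀ {y} → y ∈ₛ X ∩ ｛ x ｝ → y ∈ []
    X∩｛x｝⊆∅ y∈ with ∩⁻ {X} y∈
    ... | y∈X , y∈｛x｝ = ⊥-elim (x∉X (subst (_∈ₛ X) (sym (∈｛｝⁻ y∈｛x｝)) y∈X))

  infix 4 _∈ₛ?_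
  _∈ₛ?_ : ∀ x X → Dec (x ∈ₛ X)
  x ∈ₛ? X = Dec.map′ ∈ₛ⁺ ∈ₛ⁻ (T? (X x))

  ∃? : ∀ {P : A → Set} → Decidable P → Dec (∃ P)
  ∃? P? = Dec.map′ (λ any → let (x , _ , px) = find any in x , px)
                   (λ (x , px) → lose (∈-elements x) px)
                   (any? P? elements)

  ∣∣+∣∣≤∣∣+∣∩∣ : ∀ {X Y S} → X ⊆ S → Y ⊆ S → ∣ X ∣ + ∣ Y ∣ ≤ ∣ S ∣ + ∣ X ∩ Y ∣
  ∣∣+∣∣≤∣∣+∣∩∣ {X} {Y} X⊆S Y⊆S = begin
    ∣ X ∣ + ∣ Y ∣               ≡⟨ ∣∪∣+∣∩∣ X Y ⟨
    ∣ X ∪ Y ∣ + ∣ X ∩ Y ∣       ≤⟨ +-monoˡ-≤ _ (∣∣-mono X∪Y⊆S) ⟩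
    _ + ∣ X ∩ Y ∣               ∎
    where
    open ≤-Reasoning
    X∪Y⊆S : X ∪ Y ⊆ _
    X∪Y⊆S x∈X∪Y with ∪⁻ {X} x∈X∪Y
    ... | inj₁ x∈X = X⊆S x∈X
    ... | inj₂ x∈Y = Y⊆S x∈Y

  ∣∣≤1 : ∀ {X} → (∀ {x y} → x ∈ₛ X → y ∈ₛ X → x ≡ y) → ∣ X ∣ ≤ 1
  ∣∣≤1 {X} X-subsingleton with 1 ≤? ∣ X ∣
  ... | no ∣X∣≱1 = ≰⇒≥ ∣X∣≱1
  ... | yes 1≤∣X∣ with nonempty {X} 1≤∣X∣
  ...   | x , x∈X = ∣∣≤length {ys = x ∷ []} (λ y∈X → here (X-subsingleton y∈X x∈X))

record FiniteAbelianGroup : Set₁ where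
  infixl 7 _∙_
  infix 8 _⁻¹
  infix 4 _≟_
  field
    Carrier         : Set
    _∙_             : Op₂ Carrier
    ε               : Carrier
    _⁻¹             : Op₁ Carrier
    isAbelianGroup  : IsAbelianGroup _≡_ _∙_ ε _⁻¹
    _≟_             : DecidableEquality Carrier
    elements        : List Carrier
    ∈-elements      : ∀ x → x ∈ elements
    elements-unique : Unique elements

  abelianGroup : AbelianGroup 0ℓ 0ℓ
  abelianGroup = record { isAbelianGroup = isAbelianGroup }

  open IsAbelianGroup isAbelianGroup public using (assoc; comm; identityˡ; identityʳ; inverseˡ; inverseʳ; _-_)
  open AbelianGroupProperties abelianGroup public using (∙-cancelˡ; ∙-cancelʳ; x∙y⁻¹≈ε⇒x≈y)
  open MonoidMultiplication (AbelianGroup.monoid abelianGroup) public using (×-homo-+) renaming (_×_ to _×ᵍ_)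
  open FiniteSubsets _≟_ elements ∈-elements elements-unique public

  HasNoOrderBelow : ℕ → Set
  HasNoOrderBelow m = ∀ n x → 0 < n → n < m → n ×ᵍ x ≡ ε → x ≡ ε

  hasNoOrderBelow-mono : ∀ {m m′} → m′ ≤ m → HasNoOrderBelow m → HasNoOrderBelow m′
  hasNoOrderBelow-mono m′≤m noOrder n x 0<n n<m′ = noOrder n x 0<n (≤-trans n<m′ m′≤m)

  x∙y-x≡y : ∀ x y → (x ∙ y) - x ≡ y
  x∙y-x≡y x y = begin
    (x ∙ y) ∙ x ⁻¹   ≡⟨ cong (_∙ x ⁻¹) (comm x y) ⟩
    (y ∙ x) ∙ x ⁻¹   ≡⟨ assoc y x (x ⁻¹) ⟩
    y ∙ (x ∙ x ⁻¹)   ≡⟨ cong (y ∙_) (inverseʳ x) ⟩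
    y ∙ ε            ≡⟨ identityʳ y ⟩
    y                ∎
    where open ≡-Reasoning

  x∙[z-x]≡z : ∀ x z → x ∙ (z - x) ≡ z
  x∙[z-x]≡z x z = begin
    x ∙ (z ∙ x ⁻¹)   ≡⟨ comm x _ ⟩
    (z ∙ x ⁻¹) ∙ x   ≡⟨ assoc z (x ⁻¹) x ⟩
    z ∙ (x ⁻¹ ∙ x)   ≡⟨ cong (z ∙_) (inverseˡ x) ⟩
    z ∙ ε            ≡⟨ identityʳ z ⟩
    z                ∎
    where open ≡-Reasoning

  [x∙y]-y≡x : ∀ x y → (x ∙ y) - y ≡ x
  [x∙y]-y≡x x y = trans (cong (_- y) (comm x y)) (x∙y-x≡y y x)

  [x-y]∙y≡x : ∀ x y → (x - y) ∙ y ≡ x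
  [x-y]∙y≡x x y = trans (comm _ y) (x∙[z-x]≡z y x)

  z-[z-x]≡x : ∀ z x → z - (z - x) ≡ x
  z-[z-x]≡x z x = ∙-cancelˡ (z - x) _ _ (trans (x∙[z-x]≡z (z - x) z) (sym ([x-y]∙y≡x z x)))

  x∙x≡y∙y⇒x≡y : HasNoOrderBelow 3 → ∀ {x y} → x ∙ x ≡ y ∙ y → x ≡ y
  x∙x≡y∙y⇒x≡y noOrderBelow-3 {x} {y} x∙x≡y∙y = x∙y⁻¹≈ε⇒x≈y x y
    (noOrderBelow-3 2 (x - y) (s≤s z≤n) (s≤s (s≤s (s≤s z≤n))) (begin
      (x - y) ∙ ((x - y) ∙ ε)     ≡⟨ cong ((x - y) ∙_) (identityʳ (x - y)) ⟩
      (x ∙ y ⁻¹) ∙ (x ∙ y ⁻¹)     ≡⟨ comm∧assoc⇒middleFour comm assoc x (y ⁻¹) x (y ⁻¹) ⟩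
      (x ∙ x) ∙ (y ⁻¹ ∙ y ⁻¹)     ≡⟨ cong (_∙ (y ⁻¹ ∙ y ⁻¹)) x∙x≡y∙y ⟩
      (y ∙ y) ∙ (y ⁻¹ ∙ y ⁻¹)     ≡⟨ comm∧assoc⇒middleFour comm assoc y y (y ⁻¹) (y ⁻¹) ⟩
      (y ∙ y ⁻¹) ∙ (y ∙ y ⁻¹)     ≡⟨ cong₂ _∙_ (inverseʳ y) (inverseʳ y) ⟩
      ε ∙ ε                       ≡⟨ identityʳ ε ⟩
      ε                           ∎))
    where open ≡-Reasoning

module Sumsets (𝔾 : FiniteAbelianGroup) (p : ℕ) (noOrderBelow-p : FiniteAbelianGroup.HasNoOrderBelow 𝔾 p) where

  open AllPairs using (_∷_)

  open FiniteAbelianGroup 𝔾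

  representations : Subset → Subset → Carrier → Subset
  representations X Y z = X ∩ (λ x → Y (z - x))

  infixl 6 _⊞_
  _⊞_ : Subset → Subset → Subset
  (X ⊞ Y) z = ⌊ 1 ≤? ∣ representations X Y z ∣ ⌋

  halves : Carrier → Subset
  halves z x = ⌊ x ∙ x ≟ z ⌋

  2^_ : Subset → Subset
  (2^ X) z = ⌊ 1 ≤? ∣ representations X X z ∖ halves z ∣ ⌋

  ⊞⁺ : ∀ {X Y x y} → x ∈ₛ X → y ∈ₛ Y → x ∙ y ∈ₛ X ⊞ Y
  ⊞⁺ {X} {Y} {x} {y} x∈X (∈ₛ⁺ y∈Y) =
    ∈ₛ⁺ (fromWitness (∣∣-pos {x = x} (∩⁺ {X} x∈X (∈ₛ⁺ (subst (T ∘ Y) (sym (x∙y-x≡y x y)) y∈Y)))))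

  ⊞⁻ : ∀ {X Y z} → z ∈ₛ X ⊞ Y → ∃₂ λ x y → x ∈ₛ X × y ∈ₛ Y × z ≡ x ∙ y
  ⊞⁻ {X} {Y} {z} (∈ₛ⁺ z∈X⊞Y) with nonempty {representations X Y z} (toWitness z∈X⊞Y)
  ... | x , x∈reps with ∩⁻ {X} x∈reps
  ...   | x∈X , ∈ₛ⁺ z-x∈Y = x , z - x , x∈X , ∈ₛ⁺ z-x∈Y , sym (x∙[z-x]≡z x z)

  2^⁺ : ∀ {X x y} → x ∈ₛ X → y ∈ₛ X → x ≢ y → x ∙ y ∈ₛ 2^ X
  2^⁺ {X} {x} {y} x∈X (∈ₛ⁺ y∈X) x≢y = ∈ₛ⁺ (fromWitness (∣∣-pos {x = x} x∈reps∖halves))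
    where
    x∈reps∖halves : x ∈ₛ representations X X (x ∙ y) ∖ halves (x ∙ y)
    x∈reps∖halves = ∖⁺ {representations X X (x ∙ y)}
      (∩⁺ {X} x∈X (∈ₛ⁺ (subst (T ∘ X) (sym (x∙y-x≡y x y)) y∈X)))
      (λ (∈ₛ⁺ xx≡xy) → x≢y (∙-cancelˡ x x y (toWitness xx≡xy)))

  2^⁻ : ∀ {X z} → z ∈ₛ 2^ X → ∃₂ λ x y → x ∈ₛ X × y ∈ₛ X × x ≢ y × z ≡ x ∙ y
  2^⁻ {X} {z} (∈ₛ⁺ z∈2^X) with nonempty {representations X X z ∖ halves z} (toWitness z∈2^X)
  ... | x , x∈reps∖halves with ∖⁻ {representations X X z} x∈reps∖halves
  ...   | x∈reps , x∉halves with ∩⁻ {X} x∈reps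
  ...     | x∈X , ∈ₛ⁺ z-x∈X =
    x , z - x , x∈X , ∈ₛ⁺ z-x∈X ,
    (λ x≡z-x → x∉halves (∈ₛ⁺ (fromWitness (trans (cong (x ∙_) x≡z-x) (x∙[z-x]≡z x z))))) ,
    sym (x∙[z-x]≡z x z)

  ∣∣-translate : ∀ X g → ∣ (λ y → X (y ∙ g)) ∣ ≡ ∣ X ∣
  ∣∣-translate X g = ∣∣-∘-inverse X (_∙ g) (_- g) (λ y → [x-y]∙y≡x y g) (λ y → [x∙y]-y≡x y g)

  ∣∣-reflect : ∀ X z → ∣ (λ y → X (z - y)) ∣ ≡ ∣ X ∣
  ∣∣-reflect X z = ∣∣-∘-inverse X (z -_) (z -_) (z-[z-x]≡x z) (z-[z-x]≡x z)

  ∣X∣≤∣X⊞Y∣ : ∀ {X Y y} → y ∈ₛ Y → ∣ X ∣ ≤ ∣ X ⊞ Y ∣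
  ∣X∣≤∣X⊞Y∣ {y = y} y∈Y = ∣∣-injection (_∙ y) (λ {u} {v} → ∙-cancelʳ y u v) (λ x∈X → ⊞⁺ x∈X y∈Y)

  ∣Y∣≤∣X⊞Y∣ : ∀ {X Y x} → x ∈ₛ X → ∣ Y ∣ ≤ ∣ X ⊞ Y ∣
  ∣Y∣≤∣X⊞Y∣ {x = x} x∈X = ∣∣-injection (x ∙_) (∙-cancelˡ x _ _) (λ y∈Y → ⊞⁺ x∈X y∈Y)

  ×ᵍ-injective-below-p : ∀ {m n} d → m < n → n < p → m ×ᵍ d ≡ n ×ᵍ d → d ≡ ε
  ×ᵍ-injective-below-p {m} {n} d m<n n<p m×d≡n×d =
    noOrderBelow-p (n ∸ m) d (m<n⇒0<n∸m m<n) (≤-<-trans (m∸n≤m n m) n<p)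
      (∙-cancelʳ (m ×ᵍ d) _ _ (begin
        (n ∸ m) ×ᵍ d ∙ m ×ᵍ d  ≡⟨ ×-homo-+ d (n ∸ m) m ⟨
        (n ∸ m + m) ×ᵍ d       ≡⟨ cong (_×ᵍ d) (m∸n+n≡m (<⇒≤ m<n)) ⟩
        n ×ᵍ d                 ≡⟨ m×d≡n×d ⟨
        m ×ᵍ d                 ≡⟨ identityˡ (m ×ᵍ d) ⟨
        ε ∙ m ×ᵍ d             ∎))
    where open ≡-Reasoning

  -- X contains the p distinct elements x ∙ n d, n < p
  p≤∣∣-of-translation-closed : ∀ {X x d} → x ∈ₛ X → d ≢ ε → (∀ {y} → y ∈ₛ X → y ∙ d ∈ₛ X) → p ≤ ∣ X ∣
  p≤∣∣-of-translation-closed {X} {x} {d} x∈X d≢ε X∙d⊆X =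
    subst (_≤ ∣ X ∣) (length-tabulate orbit) (length≤∣∣ (Unique.tabulate⁺ orbit-injective) orbit⊆X)
    where
    orbit : Fin p → Carrier
    orbit i = x ∙ toℕ i ×ᵍ d

    orbit-injective : ∀ {i j} → orbit i ≡ orbit j → i ≡ j
    orbit-injective {i} {j} eq with <-cmp (toℕ i) (toℕ j)
    ... | tri< i<j _ _ = ⊥-elim (d≢ε (×ᵍ-injective-below-p d i<j (toℕ<n j) (∙-cancelˡ x _ _ eq)))
    ... | tri≈ _ i≡j _ = toℕ-injective i≡j
    ... | tri> _ _ j<i = ⊥-elim (d≢ε (×ᵍ-injective-below-p d j<i (toℕ<n i) (∙-cancelˡ x _ _ (sym eq))))

    x∙n×d∈X : ∀ n → x ∙ n ×ᵍ d ∈ₛ X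
    x∙n×d∈X zero    = subst (_∈ₛ X) (sym (identityʳ x)) x∈X
    x∙n×d∈X (suc n) = subst (_∈ₛ X) (x∙[n×d]∙d≡x∙[d∙n×d] n) (X∙d⊆X (x∙n×d∈X n))
      where
      x∙[n×d]∙d≡x∙[d∙n×d] : ∀ n → x ∙ n ×ᵍ d ∙ d ≡ x ∙ (d ∙ n ×ᵍ d)
      x∙[n×d]∙d≡x∙[d∙n×d] n = trans (assoc x _ d) (cong (x ∙_) (comm _ d))

    orbit⊆X : ∀ {y} → y ∈ tabulate orbit → y ∈ₛ X
    orbit⊆X y∈orbit with ∈-tabulate⁻ y∈orbit
    ... | i , refl = x∙n×d∈X (toℕ i)

  CauchyDavenportBound : Subset → Subset → Set
  CauchyDavenportBound X Y = p ≤ ∣ X ⊞ Y ∣ ⊎ ∣ X ∣ + ∣ Y ∣ ≤ suc ∣ X ⊞ Y ∣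

  module DysonTransform {X Y x a b} (x∈X : x ∈ₛ X) (a∈Y : a ∈ₛ Y) (b∈Y : b ∈ₛ Y)
                        (b∙[x-a]∉X : ¬ b ∙ (x - a) ∈ₛ X) where

    e : Carrier
    e = x - a

    X′ Y′ : Subset
    X′ = X ∪ (λ y → Y (y - e))
    Y′ = Y ∩ (λ y → X (y ∙ e))

    a∈Y′ : a ∈ₛ Y′
    a∈Y′ = ∩⁺ {Y} a∈Y (∈ₛ⁺ (∈ₛ⁻ (subst (_∈ₛ X) (sym (x∙[z-x]≡z a x)) x∈X)))

    ∣Y′∣<∣Y∣ : ∣ Y′ ∣ < ∣ Y ∣
    ∣Y′∣<∣Y∣ = ∣∣-strict (λ y∈Y′ → proj₁ (∩⁻ {Y} y∈Y′)) b∈Y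
                        (λ b∈Y′ → b∙[x-a]∉X (∈ₛ⁺ (∈ₛ⁻ (proj₂ (∩⁻ {Y} b∈Y′)))))

    ∣X′∣+∣Y′∣≡∣X∣+∣Y∣ : ∣ X′ ∣ + ∣ Y′ ∣ ≡ ∣ X ∣ + ∣ Y ∣
    ∣X′∣+∣Y′∣≡∣X∣+∣Y∣ = begin
      ∣ X′ ∣ + ∣ Y′ ∣                           ≡⟨ cong (∣ X′ ∣ +_) ∣Y′∣≡∣X∩[Y+e]∣ ⟩
      ∣ X′ ∣ + ∣ X ∩ (λ y → Y (y - e)) ∣        ≡⟨ ∣∪∣+∣∩∣ X _ ⟩
      ∣ X ∣ + ∣ (λ y → Y (y - e)) ∣             ≡⟨ cong (∣ X ∣ +_) (∣∣-translate Y (e ⁻¹)) ⟩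
      ∣ X ∣ + ∣ Y ∣                             ∎
      where
      open ≡-Reasoning
      ∣Y′∣≡∣X∩[Y+e]∣ : ∣ Y′ ∣ ≡ ∣ X ∩ (λ y → Y (y - e)) ∣
      ∣Y′∣≡∣X∩[Y+e]∣ = trans (∣∣-cong (λ y → trans (∧-comm (Y y) _) (cong (λ t → X (y ∙ e) ∧ Y t) (sym ([x∙y]-y≡x y e)))))
                             (∣∣-translate (X ∩ (λ y → Y (y - e))) e)

    X′⊞Y′⊆X⊞Y : X′ ⊞ Y′ ⊆ X ⊞ Y
    X′⊞Y′⊆X⊞Y z∈X′⊞Y′ with ⊞⁻ {X′} z∈X′⊞Y′
    ... | u , v , u∈X′ , v∈Y′ , refl with ∩⁻ {Y} {λ y → X (y ∙ e)} v∈Y′ | ∪⁻ {X} {λ y → Y (y - e)} u∈X′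
    ...   | v∈Y , _          | inj₁ u∈X   = ⊞⁺ u∈X v∈Y
    ...   | _   , ∈ₛ⁺ v∙e∈X | inj₂ (∈ₛ⁺ u-e∈Y) =
      subst (_∈ₛ X ⊞ Y) [v∙e]∙[u-e]≡u∙v (⊞⁺ {X} {Y} (∈ₛ⁺ v∙e∈X) (∈ₛ⁺ u-e∈Y))
      where
      [v∙e]∙[u-e]≡u∙v : (v ∙ e) ∙ (u - e) ≡ u ∙ v
      [v∙e]∙[u-e]≡u∙v = begin
        (v ∙ e) ∙ (u ∙ e ⁻¹)   ≡⟨ comm∧assoc⇒middleFour comm assoc v e u (e ⁻¹) ⟩
        (v ∙ u) ∙ (e ∙ e ⁻¹)   ≡⟨ cong₂ _∙_ (comm v u) (inverseʳ e) ⟩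
        (u ∙ v) ∙ ε            ≡⟨ identityʳ (u ∙ v) ⟩
        u ∙ v                  ∎
        where open ≡-Reasoning

    bound-transfer : CauchyDavenportBound X′ Y′ → CauchyDavenportBound X Y
    bound-transfer (inj₁ p≤∣X′⊞Y′∣) = inj₁ (≤-trans p≤∣X′⊞Y′∣ (∣∣-mono X′⊞Y′⊆X⊞Y))
    bound-transfer (inj₂ ∣X′∣+∣Y′∣≤) =
      inj₂ (subst (_≤ suc ∣ X ⊞ Y ∣) ∣X′∣+∣Y′∣≡∣X∣+∣Y∣ (≤-trans ∣X′∣+∣Y′∣≤ (s≤s (∣∣-mono X′⊞Y′⊆X⊞Y))))

  -- By strong induction on ∣ Y ∣: either some x ∈ X, a, b ∈ Y have b ∙ (x - a) ∉ X and Dyson's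
  -- transform shrinks Y, or X is closed under translation by every b - a and so has p elements.
  cauchyDavenport : ∀ {X Y x y} → x ∈ₛ X → y ∈ₛ Y → CauchyDavenportBound X Y
  cauchyDavenport {Y = Y} = <-rec Motive step ∣ Y ∣ refl
    where
    Motive : ℕ → Set
    Motive n = ∀ {X Y x y} → ∣ Y ∣ ≡ n → x ∈ₛ X → y ∈ₛ Y → CauchyDavenportBound X Y

    step : ∀ n → (∀ {m} → m < n → Motive m) → Motive n
    step n rec {X} {Y} {x₀} {y₀} refl x₀∈X y₀∈Y with 2 ≤? ∣ Y ∣
    ... | no ∣Y∣≱2 = inj₂ (≤-trans (+-mono-≤ (∣X∣≤∣X⊞Y∣ y₀∈Y) (s≤s⁻¹ (≰⇒> ∣Y∣≱2))) (≤-reflexive (+-comm _ 1)))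
    ... | yes 2≤∣Y∣ with ∃? (λ x → ∃? (λ a → ∃? (λ b → x ∈ₛ? X ×-dec a ∈ₛ? Y ×-dec b ∈ₛ? Y ×-dec ¬? (b ∙ (x - a) ∈ₛ? X))))
    ... | yes (x , a , b , x∈X , a∈Y , b∈Y , b∙[x-a]∉X) =
      bound-transfer (rec ∣Y′∣<∣Y∣ refl (∪⁺ˡ {X} x₀∈X) a∈Y′)
      where open DysonTransform x∈X a∈Y b∈Y b∙[x-a]∉X
    ... | no no-bad-triple = closed-under-translation (another y₀ 2≤∣Y∣)
      where
      closed-under-translation : (∃ λ y₁ → y₁ ∈ₛ Y × y₁ ≢ y₀) → CauchyDavenportBound X Y
      closed-under-translation (y₁ , y₁∈Y , y₁≢y₀) =
        inj₁ (≤-trans (p≤∣∣-of-translation-closed x₀∈X d≢ε X∙d⊆X) (∣X∣≤∣X⊞Y∣ y₀∈Y))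
        where
        d : Carrier
        d = y₁ - y₀
        d≢ε : d ≢ ε
        d≢ε d≡ε = y₁≢y₀ (x∙y⁻¹≈ε⇒x≈y y₁ y₀ d≡ε)
        X∙d⊆X : ∀ {g} → g ∈ₛ X → g ∙ d ∈ₛ X
        X∙d⊆X {g} g∈X = subst (_∈ₛ X) y₁∙[g-y₀]≡g∙d
          (decidable-stable (_ ∈ₛ? X) λ ∉X → no-bad-triple (g , y₀ , y₁ , g∈X , y₀∈Y , y₁∈Y , ∉X))
          where
          y₁∙[g-y₀]≡g∙d : y₁ ∙ (g - y₀) ≡ g ∙ d
          y₁∙[g-y₀]≡g∙d = trans (sym (assoc y₁ g _)) (trans (cong (_∙ y₀ ⁻¹) (comm y₁ g)) (assoc g y₁ _))

  -- X′ ⊞ P lies in 2^ X but misses x ∙ y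
  private module RemoveTwoPoints {X x y} (x∈X : x ∈ₛ X) (y∈X : y ∈ₛ X) (y≢x : y ≢ x) where

    X′ P : Subset
    X′ = (X ∖ ｛ x ｝) ∖ ｛ y ｝
    P  = ｛ x ｝ ∪ ｛ y ｝

    ∣X∣≤2+∣X′∣ : ∣ X ∣ ≤ 2 + ∣ X′ ∣
    ∣X∣≤2+∣X′∣ = ≤-trans (∣∣≤1+∣∖｛｝∣ X x) (s≤s (∣∣≤1+∣∖｛｝∣ (X ∖ ｛ x ｝) y))

    X′-nonempty : 3 ≤ ∣ X ∣ → ∃ (_∈ₛ X′)
    X′-nonempty 3≤∣X∣ = nonempty {X′} (s≤s⁻¹ (s≤s⁻¹ (≤-trans 3≤∣X∣ ∣X∣≤2+∣X′∣)))

    2≤∣P∣ : 2 ≤ ∣ P ∣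
    2≤∣P∣ = ≤-trans (s≤s (∣∣-pos (∈｛｝ x)))
              (∣∣-strict {｛ x ｝} (∪⁺ˡ {｛ x ｝}) (∪⁺ʳ {｛ x ｝} (∈｛｝ y)) (λ y∈｛x｝ → y≢x (sym (∈｛｝⁻ y∈｛x｝))))

    P∋x∨y : ∀ {v} → v ∈ₛ P → v ≡ x ⊎ v ≡ y
    P∋x∨y v∈P with ∪⁻ {｛ x ｝} v∈P
    ... | inj₁ v∈｛x｝ = inj₁ (sym (∈｛｝⁻ v∈｛x｝))
    ... | inj₂ v∈｛y｝ = inj₂ (sym (∈｛｝⁻ v∈｛y｝))

    X′∌x,y : ∀ {u} → u ∈ₛ X′ → u ∈ₛ X × u ≢ x × u ≢ y
    X′∌x,y {u} u∈X′ with ∖⁻ {X ∖ ｛ x ｝} u∈X′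
    ... | u∈X∖｛x｝ , u∉｛y｝ with ∖⁻ {X} u∈X∖｛x｝
    ...   | u∈X , u∉｛x｝ = u∈X , (λ u≡x → u∉｛x｝ (subst (_∈ₛ ｛ x ｝) (sym u≡x) (∈｛｝ x)))
                                 , (λ u≡y → u∉｛y｝ (subst (_∈ₛ ｛ y ｝) (sym u≡y) (∈｛｝ y)))

    X′⊞P⊆2^X : X′ ⊞ P ⊆ 2^ X
    X′⊞P⊆2^X z∈X′⊞P with ⊞⁻ {X′} z∈X′⊞P
    ... | u , v , u∈X′ , v∈P , refl with X′∌x,y u∈X′ | P∋x∨y v∈P
    ...   | u∈X , u≢x , _   | inj₁ refl = 2^⁺ u∈X x∈X u≢x
    ...   | u∈X , _   , u≢y | inj₂ refl = 2^⁺ u∈X y∈X u≢y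

    x∙y∉X′⊞P : ¬ x ∙ y ∈ₛ X′ ⊞ P
    x∙y∉X′⊞P x∙y∈X′⊞P with ⊞⁻ {X′} x∙y∈X′⊞P
    ... | u , v , u∈X′ , v∈P , x∙y≡u∙v with X′∌x,y u∈X′ | P∋x∨y v∈P
    ...   | _ , _ , u≢y | inj₁ refl = u≢y (∙-cancelʳ x u y (trans (sym x∙y≡u∙v) (comm x y)))
    ...   | _ , u≢x , _ | inj₂ refl = u≢x (sym (∙-cancelʳ y x u x∙y≡u∙v))

    ∣X′⊞P∣<∣2^X∣ : ∣ X′ ⊞ P ∣ < ∣ 2^ X ∣
    ∣X′⊞P∣<∣2^X∣ = ∣∣-strict X′⊞P⊆2^X (2^⁺ x∈X y∈X (λ x≡y → y≢x (sym x≡y))) x∙y∉X′⊞P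

  weakErdősHeilbronn : ∀ {X} → 3 ≤ ∣ X ∣ → p ≤ ∣ 2^ X ∣ ⊎ ∣ X ∣ ≤ ∣ 2^ X ∣
  weakErdősHeilbronn {X} 3≤∣X∣ with nonempty {X} (≤-trans (s≤s z≤n) 3≤∣X∣)
  ... | x , x∈X with another {X} x (≤-trans (n≤1+n 2) 3≤∣X∣)
  ... | y , y∈X , y≢x = conclude (cauchyDavenport (proj₂ (X′-nonempty 3≤∣X∣)) (∪⁺ˡ {｛ x ｝} (∈｛｝ x)))
    where
    open RemoveTwoPoints x∈X y∈X y≢x
    conclude : CauchyDavenportBound X′ P → p ≤ ∣ 2^ X ∣ ⊎ ∣ X ∣ ≤ ∣ 2^ X ∣
    conclude (inj₁ p≤∣X′⊞P∣) = inj₁ (≤-trans p≤∣X′⊞P∣ (<⇒≤ ∣X′⊞P∣<∣2^X∣))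
    conclude (inj₂ ∣X′∣+∣P∣≤) = inj₂ (begin
      ∣ X ∣                  ≤⟨ ∣X∣≤2+∣X′∣ ⟩
      2 + ∣ X′ ∣             ≡⟨ +-comm 2 ∣ X′ ∣ ⟩
      ∣ X′ ∣ + 2             ≤⟨ +-monoʳ-≤ ∣ X′ ∣ 2≤∣P∣ ⟩
      ∣ X′ ∣ + ∣ P ∣         ≤⟨ ∣X′∣+∣P∣≤ ⟩
      suc ∣ X′ ⊞ P ∣         ≤⟨ ∣X′⊞P∣<∣2^X∣ ⟩
      ∣ 2^ X ∣               ∎)
      where open ≤-Reasoning

  module Fibres (𝔹 : FiniteAbelianGroup) (π : Carrier → FiniteAbelianGroup.Carrier 𝔹)
                (π-homo : ∀ x y → π (x ∙ y) ≡ FiniteAbelianGroup._∙_ 𝔹 (π x) (π y)) where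

    private module B = FiniteAbelianGroup 𝔹

    fibre : B.Carrier → Subset
    fibre i x = ⌊ π x B.≟ i ⌋

    fibre⁺ : ∀ {x i} → π x ≡ i → x ∈ₛ fibre i
    fibre⁺ {x} {i} πx≡i = ∈ₛ⁺ (fromWitness {a? = π x B.≟ i} πx≡i)

    fibre⁻ : ∀ {x i} → x ∈ₛ fibre i → π x ≡ i
    fibre⁻ {x} {i} (∈ₛ⁺ x∈fibre) = toWitness {a? = π x B.≟ i} x∈fibre

    π-ε : π ε ≡ B.ε
    π-ε = B.∙-cancelˡ (π ε) _ _ (trans (sym (π-homo ε ε)) (trans (cong π (identityʳ ε)) (sym (B.identityʳ (π ε)))))

    π-⁻¹ : ∀ x → π (x ⁻¹) ≡ π x B.⁻¹
    π-⁻¹ x = B.∙-cancelˡ (π x) _ _ (trans (sym (π-homo x (x ⁻¹)))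
              (trans (cong π (inverseʳ x)) (trans π-ε (sym (B.inverseʳ (π x))))))

    π-- : ∀ x y → π (x - y) ≡ π x B.- π y
    π-- x y = trans (π-homo x (y ⁻¹)) (cong (π x B.∙_) (π-⁻¹ y))

    kernel : Subset
    kernel = fibre B.ε

    ∣fibre∣≡∣kernel∣ : ∀ {i x} → x ∈ₛ fibre i → ∣ fibre i ∣ ≡ ∣ kernel ∣
    ∣fibre∣≡∣kernel∣ {i} {x} x∈fibre = ≤-antisym
      (∣∣-injection (_- x) (λ {u} {v} → ∙-cancelʳ (x ⁻¹) u v)
        (λ {y} y∈fibre → fibre⁺ (trans (π-- y x) (trans (cong₂ B._-_ (fibre⁻ y∈fibre) (fibre⁻ x∈fibre)) (B.inverseʳ i)))))
      (∣∣-injection (_∙ x) (λ {u} {v} → ∙-cancelʳ x u v)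
        (λ {y} y∈kernel → fibre⁺ (trans (π-homo y x) (trans (cong₂ B._∙_ (fibre⁻ y∈kernel) (fibre⁻ x∈fibre)) (B.identityˡ i)))))

    ∣fibre∣≤∣kernel∣ : ∀ i → ∣ fibre i ∣ ≤ ∣ kernel ∣
    ∣fibre∣≤∣kernel∣ i with 1 ≤? ∣ fibre i ∣
    ... | yes 1≤∣fibre∣ = ≤-reflexive (∣fibre∣≡∣kernel∣ (proj₂ (nonempty {fibre i} 1≤∣fibre∣)))
    ... | no ∣fibre∣≱1  = ≤-trans (s≤s⁻¹ (≰⇒> ∣fibre∣≱1)) z≤n

    ⊞-fibre : ∀ {X Y i j} → X ⊆ fibre i → Y ⊆ fibre j → X ⊞ Y ⊆ fibre (i B.∙ j)
    ⊞-fibre {X} X⊆fibre Y⊆fibre z∈X⊞Y with ⊞⁻ {X} z∈X⊞Y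
    ... | x , y , x∈X , y∈Y , refl = fibre⁺ (trans (π-homo x y) (cong₂ B._∙_ (fibre⁻ (X⊆fibre x∈X)) (fibre⁻ (Y⊆fibre y∈Y))))

    reflect-fibre : ∀ {Y i j z} → Y ⊆ fibre j → z ∈ₛ fibre (i B.∙ j) → (λ y → Y (z - y)) ⊆ fibre i
    reflect-fibre {Y} {i} {j} {z} Y⊆fibre z∈fibre {y} (∈ₛ⁺ z-y∈Y) = fibre⁺ (begin
      π y                   ≡⟨ cong π (z-[z-x]≡x z y) ⟨
      π (z - (z - y))       ≡⟨ π-- z (z - y) ⟩
      π z B.- π (z - y)     ≡⟨ cong₂ B._-_ (fibre⁻ z∈fibre) (fibre⁻ (Y⊆fibre (∈ₛ⁺ z-y∈Y))) ⟩
      (i B.∙ j) B.- j       ≡⟨ B.[x∙y]-y≡x i j ⟩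
      i                     ∎)
      where open ≡-Reasoning

    -- X and z - Y are both inside the fibre over i, which has only ∣ kernel ∣ points
    ∣X∣+∣Y∣≤∣kernel∣+∣representations∣ : ∀ {X Y i j z} → X ⊆ fibre i → Y ⊆ fibre j → z ∈ₛ fibre (i B.∙ j) →
                                         ∣ X ∣ + ∣ Y ∣ ≤ ∣ kernel ∣ + ∣ representations X Y z ∣
    ∣X∣+∣Y∣≤∣kernel∣+∣representations∣ {X} {Y} {i} {j} {z} X⊆fibre Y⊆fibre z∈fibre = begin
      ∣ X ∣ + ∣ Y ∣                               ≡⟨ cong (∣ X ∣ +_) (∣∣-reflect Y z) ⟨
      ∣ X ∣ + ∣ (λ y → Y (z - y)) ∣               ≤⟨ ∣∣+∣∣≤∣∣+∣∩∣ X⊆fibre (reflect-fibre {Y} Y⊆fibre z∈fibre) ⟩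
      ∣ fibre i ∣ + ∣ representations X Y z ∣     ≤⟨ +-monoˡ-≤ _ (∣fibre∣≤∣kernel∣ i) ⟩
      ∣ kernel ∣ + ∣ representations X Y z ∣      ∎
      where open ≤-Reasoning

    pigeonhole : ∀ {X Y i j} → X ⊆ fibre i → Y ⊆ fibre j → ∣ kernel ∣ < ∣ X ∣ + ∣ Y ∣ → fibre (i B.∙ j) ⊆ X ⊞ Y
    pigeonhole {X} {Y} X⊆fibre Y⊆fibre ∣kernel∣<∣X∣+∣Y∣ z∈fibre = ∈ₛ⁺ (fromWitness
      (+-cancelˡ-≤ ∣ kernel ∣ 1 _ (≤-trans (≤-trans (≤-reflexive (+-comm _ 1)) ∣kernel∣<∣X∣+∣Y∣)
                                          (∣X∣+∣Y∣≤∣kernel∣+∣representations∣ X⊆fibre Y⊆fibre z∈fibre))))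

    -- at least two representations of z, and at most one of the form x ∙ x since nothing has order 2
    restricted-pigeonhole : 2 < p → ∀ {X i} → X ⊆ fibre i → ∣ kernel ∣ + 2 ≤ 2 * ∣ X ∣ → fibre (i B.∙ i) ⊆ 2^ X
    restricted-pigeonhole 2<p {X} X⊆fibre ∣kernel∣+2≤2∣X∣ {z} z∈fibre = ∈ₛ⁺ (fromWitness (s≤s⁻¹ (begin
      2                                        ≤⟨ 2≤∣R∣ ⟩
      ∣ R ∣                                    ≡⟨ ∣∣≡∣∩∣+∣∖∣ R (halves z) ⟩
      ∣ R ∩ halves z ∣ + ∣ R ∖ halves z ∣      ≤⟨ +-monoˡ-≤ _ (∣∣≤1 {R ∩ halves z} halves-subsingleton) ⟩
      suc ∣ R ∖ halves z ∣                     ∎)))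
      where
      open ≤-Reasoning
      R : Subset
      R = representations X X z
      2≤∣R∣ : 2 ≤ ∣ R ∣
      2≤∣R∣ = +-cancelˡ-≤ ∣ kernel ∣ 2 _ (begin
        ∣ kernel ∣ + 2        ≤⟨ ∣kernel∣+2≤2∣X∣ ⟩
        2 * ∣ X ∣             ≡⟨ cong (∣ X ∣ +_) (+-identityʳ ∣ X ∣) ⟩
        ∣ X ∣ + ∣ X ∣         ≤⟨ ∣X∣+∣Y∣≤∣kernel∣+∣representations∣ X⊆fibre X⊆fibre z∈fibre ⟩
        ∣ kernel ∣ + ∣ R ∣    ∎)
      halves-subsingleton : ∀ {x y} → x ∈ₛ R ∩ halves z → y ∈ₛ R ∩ halves z → x ≡ y
      halves-subsingleton x∈ y∈ with ∈ₛ⁺ x∙x≡z ← proj₂ (∩⁻ {R} x∈) | ∈ₛ⁺ y∙y≡z ← proj₂ (∩⁻ {R} y∈) =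
        x∙x≡y∙y⇒x≡y (hasNoOrderBelow-mono 2<p noOrderBelow-p) (trans (toWitness x∙x≡z) (sym (toWitness y∙y≡z)))

    ∣kernel∣≤∣X⊞Y∣ : ∀ {X Y i j x y} → X ⊆ fibre i → Y ⊆ fibre j → x ∈ₛ X → y ∈ₛ Y →
                     ∣ kernel ∣ < ∣ X ∣ + ∣ Y ∣ → ∣ kernel ∣ ≤ ∣ X ⊞ Y ∣
    ∣kernel∣≤∣X⊞Y∣ {X} {Y} {i} {j} X⊆fibre Y⊆fibre x∈X y∈Y ∣kernel∣<∣X∣+∣Y∣ = begin
      ∣ kernel ∣           ≡⟨ ∣fibre∣≡∣kernel∣ (⊞-fibre {X} X⊆fibre Y⊆fibre (⊞⁺ x∈X y∈Y)) ⟨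
      ∣ fibre (i B.∙ j) ∣  ≤⟨ ∣∣-mono (pigeonhole {X} X⊆fibre Y⊆fibre ∣kernel∣<∣X∣+∣Y∣) ⟩
      ∣ X ⊞ Y ∣            ∎
      where open ≤-Reasoning

    ∣kernel∣≤∣2^X∣ : 2 < p → ∀ {X i x} → X ⊆ fibre i → x ∈ₛ X → ∣ kernel ∣ + 2 ≤ 2 * ∣ X ∣ → ∣ kernel ∣ ≤ ∣ 2^ X ∣
    ∣kernel∣≤∣2^X∣ 2<p {X} {i} {x} X⊆fibre x∈X ∣kernel∣+2≤2∣X∣ = begin
      ∣ kernel ∣           ≡⟨ ∣fibre∣≡∣kernel∣ x∙x∈fibre ⟨
      ∣ fibre (i B.∙ i) ∣  ≤⟨ ∣∣-mono (restricted-pigeonhole 2<p X⊆fibre ∣kernel∣+2≤2∣X∣) ⟩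
      ∣ 2^ X ∣             ∎
      where
      open ≤-Reasoning
      x∙x∈fibre : x ∙ x ∈ₛ fibre (i B.∙ i)
      x∙x∈fibre = fibre⁺ (trans (π-homo x x) (cong₂ B._∙_ (fibre⁻ (X⊆fibre x∈X)) (fibre⁻ (X⊆fibre x∈X))))

    Σ∣∩fibre∣ : Subset → List B.Carrier → ℕ
    Σ∣∩fibre∣ X is = sum (map (λ i → ∣ X ∩ fibre i ∣) is)

    Σ∣∩fibre∣-mono : ∀ {X Y} is → (∀ {j} → j ∈ is → X ∩ fibre j ⊆ Y ∩ fibre j) → Σ∣∩fibre∣ X is ≤ Σ∣∩fibre∣ Y is
    Σ∣∩fibre∣-mono _ X∩fibre⊆ = sum-map-mono (λ j∈is → ∣∣-mono (X∩fibre⊆ j∈is))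

    Σ∣∩fibre∣≤∣∣ : ∀ X {is} → Unique is → Σ∣∩fibre∣ X is ≤ ∣ X ∣
    Σ∣∩fibre∣≤∣∣ X {[]} _ = z≤n
    Σ∣∩fibre∣≤∣∣ X {i ∷ is} (i∉is ∷ is!) = begin
      ∣ X ∩ fibre i ∣ + Σ∣∩fibre∣ X is                ≤⟨ +-monoʳ-≤ _ (Σ∣∩fibre∣-mono is X∩fibre⊆) ⟩
      ∣ X ∩ fibre i ∣ + Σ∣∩fibre∣ (X ∖ fibre i) is    ≤⟨ +-monoʳ-≤ _ (Σ∣∩fibre∣≤∣∣ (X ∖ fibre i) is!) ⟩
      ∣ X ∩ fibre i ∣ + ∣ X ∖ fibre i ∣               ≡⟨ ∣∣≡∣∩∣+∣∖∣ X (fibre i) ⟨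
      ∣ X ∣                                           ∎
      where
      open ≤-Reasoning
      X∩fibre⊆ : ∀ {j} → j ∈ is → X ∩ fibre j ⊆ (X ∖ fibre i) ∩ fibre j
      X∩fibre⊆ j∈is x∈X∩fibre = let (x∈X , x∈fibre) = ∩⁻ {X} x∈X∩fibre in
        ∩⁺ {X ∖ fibre i} (∖⁺ {X} x∈X λ x∈fibre-i →
          All.lookup i∉is j∈is (trans (sym (fibre⁻ x∈fibre-i)) (fibre⁻ x∈fibre))) x∈fibre

    ∣∣≤Σ∣∩fibre∣ : ∀ X is → (∀ {x} → x ∈ₛ X → π x ∈ is) → ∣ X ∣ ≤ Σ∣∩fibre∣ X is
    ∣∣≤Σ∣∩fibre∣ X [] π[X]⊆[] = ∣∣≤length {ys = []} π[X]⊆[]′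
      where π[X]⊆[]′ : ∀ {x} → x ∈ₛ X → x ∈ []
            π[X]⊆[]′ x∈X with () ← π[X]⊆[] x∈X
    ∣∣≤Σ∣∩fibre∣ X (i ∷ is) π[X]⊆i∷is = begin
      ∣ X ∣                                           ≡⟨ ∣∣≡∣∩∣+∣∖∣ X (fibre i) ⟩
      ∣ X ∩ fibre i ∣ + ∣ X ∖ fibre i ∣               ≤⟨ +-monoʳ-≤ _ (∣∣≤Σ∣∩fibre∣ (X ∖ fibre i) is π[X∖fibre]⊆is) ⟩
      ∣ X ∩ fibre i ∣ + Σ∣∩fibre∣ (X ∖ fibre i) is    ≤⟨ +-monoʳ-≤ _ (Σ∣∩fibre∣-mono is (λ _ → ∖∩fibre⊆∩fibre)) ⟩
      ∣ X ∩ fibre i ∣ + Σ∣∩fibre∣ X is                ∎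
      where
      open ≤-Reasoning
      π[X∖fibre]⊆is : ∀ {x} → x ∈ₛ X ∖ fibre i → π x ∈ is
      π[X∖fibre]⊆is x∈X∖fibre with ∖⁻ {X} x∈X∖fibre
      ... | x∈X , x∉fibre with π[X]⊆i∷is x∈X
      ...   | here πx≡i   = ⊥-elim (x∉fibre (fibre⁺ πx≡i))
      ...   | there πx∈is = πx∈is
      ∖∩fibre⊆∩fibre : ∀ {j} → (X ∖ fibre i) ∩ fibre j ⊆ X ∩ fibre j
      ∖∩fibre⊆∩fibre x∈ = let (x∈X∖fibre , x∈fibre) = ∩⁻ {X ∖ fibre i} x∈ in ∩⁺ {X} (proj₁ (∖⁻ {X} x∈X∖fibre)) x∈fibre

    ⊞⊆2^∩fibre : ∀ {X Y Z i j} → X ⊆ Z ∩ fibre i → Y ⊆ Z ∩ fibre j → i ≢ j → X ⊞ Y ⊆ 2^ Z ∩ fibre (i B.∙ j)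
    ⊞⊆2^∩fibre {X} {Y} {Z} {i} {j} X⊆ Y⊆ i≢j z∈X⊞Y with ⊞⁻ {X} z∈X⊞Y
    ... | x , y , x∈X , y∈Y , refl with ∩⁻ {Z} (X⊆ x∈X) | ∩⁻ {Z} (Y⊆ y∈Y)
    ...   | x∈Z , x∈fibre | y∈Z , y∈fibre =
      ∩⁺ {2^ Z} (2^⁺ x∈Z y∈Z λ x≡y → i≢j (trans (sym (fibre⁻ x∈fibre)) (trans (cong π x≡y) (fibre⁻ y∈fibre))))
                (fibre⁺ (trans (π-homo x y) (cong₂ B._∙_ (fibre⁻ x∈fibre) (fibre⁻ y∈fibre))))

    2^⊆2^∩fibre : ∀ {X Z i} → X ⊆ Z ∩ fibre i → 2^ X ⊆ 2^ Z ∩ fibre (i B.∙ i)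
    2^⊆2^∩fibre {X} {Z} {i} X⊆ z∈2^X with 2^⁻ {X} z∈2^X
    ... | x , y , x∈X , y∈X , x≢y , refl with ∩⁻ {Z} (X⊆ x∈X) | ∩⁻ {Z} (X⊆ y∈X)
    ...   | x∈Z , x∈fibre | y∈Z , y∈fibre =
      ∩⁺ {2^ Z} (2^⁺ x∈Z y∈Z x≢y) (fibre⁺ (trans (π-homo x y) (cong₂ B._∙_ (fibre⁻ x∈fibre) (fibre⁻ y∈fibre))))

comm∧assoc∧idʳ∧invʳ⇒isAbelianGroup : ∀ {A : Set} {_∙_ : Op₂ A} {ε : A} {_⁻¹ : Op₁ A} →
  (∀ x y → x ∙ y ≡ y ∙ x) → (∀ x y z → (x ∙ y) ∙ z ≡ x ∙ (y ∙ z)) →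
  (∀ x → x ∙ ε ≡ x) → (∀ x → x ∙ (x ⁻¹) ≡ ε) →
  IsAbelianGroup _≡_ _∙_ ε _⁻¹
comm∧assoc∧idʳ∧invʳ⇒isAbelianGroup {_∙_ = _∙_} {_⁻¹ = _⁻¹} comm assoc idʳ invʳ = record
  { isGroup = record
    { isMonoid = record
      { isSemigroup = record { isMagma = isMagma _∙_ ; assoc = assoc }
      ; identity = comm∧idʳ⇒id comm idʳ
      }
    ; inverse = comm∧invʳ⇒inv comm invʳ
    ; ⁻¹-cong = cong _⁻¹
    }
  ; comm = comm
  }

infixr 2 _⊗_
_⊗_ : FiniteAbelianGroup → FiniteAbelianGroup → FiniteAbelianGroup
𝔾 ⊗ ℍ = record
  { Carrier         = G.Carrier × H.Carrier
  ; _∙_             = _∙_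
  ; ε               = G.ε , H.ε
  ; _⁻¹             = λ (g , h) → g G.⁻¹ , h H.⁻¹
  ; isAbelianGroup  = comm∧assoc∧idʳ∧invʳ⇒isAbelianGroup
      (λ (g , h) (g′ , h′) → cong₂ _,_ (G.comm g g′) (H.comm h h′))
      (λ (g , h) (g′ , h′) (g″ , h″) → cong₂ _,_ (G.assoc g g′ g″) (H.assoc h h′ h″))
      (λ (g , h) → cong₂ _,_ (G.identityʳ g) (H.identityʳ h))
      (λ (g , h) → cong₂ _,_ (G.inverseʳ g) (H.inverseʳ h))
  ; _≟_             = ≡-dec G._≟_ H._≟_
  ; elements        = cartesianProduct G.elements H.elements
  ; ∈-elements      = λ (g , h) → ∈-cartesianProduct⁺ (G.∈-elements g) (H.∈-elements h)
  ; elements-unique = Unique.cartesianProduct⁺ G.elements-unique H.elements-unique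
  }
  where
  module G = FiniteAbelianGroup 𝔾
  module H = FiniteAbelianGroup ℍ
  _∙_ : Op₂ (G.Carrier × H.Carrier)
  (g , h) ∙ (g′ , h′) = g G.∙ g′ , h H.∙ h′

module _ (𝔾 ℍ : FiniteAbelianGroup) where
  private
    module G = FiniteAbelianGroup 𝔾
    module H = FiniteAbelianGroup ℍ
    module GH = FiniteAbelianGroup (𝔾 ⊗ ℍ)

  ×ᵍ-⊗ : ∀ n g h → n GH.×ᵍ (g , h) ≡ (n G.×ᵍ g , n H.×ᵍ h)
  ×ᵍ-⊗ zero    g h = refl
  ×ᵍ-⊗ (suc n) g h = cong ((g , h) GH.∙_) (×ᵍ-⊗ n g h)

  ⊗-hasNoOrderBelow : ∀ {m} → G.HasNoOrderBelow m → H.HasNoOrderBelow m → GH.HasNoOrderBelow m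
  ⊗-hasNoOrderBelow G-noOrder H-noOrder n (g , h) 0<n n<m n×gh≡ε = cong₂ _,_
    (G-noOrder n g 0<n n<m (,-injectiveˡ (trans (sym (×ᵍ-⊗ n g h)) n×gh≡ε)))
    (H-noOrder n h 0<n n<m (,-injectiveʳ (trans (sym (×ᵍ-⊗ n g h)) n×gh≡ε)))

module _ {p : ℕ} .{{_ : NonZero p}} where

  private
    toℕ-+ₚ : (a b : Fin p) → toℕ (a +ₚ b) ≡ (toℕ a + toℕ b) % p
    toℕ-+ₚ a b = toℕ-fromℕ< _

    toℕ-0ₚ : toℕ (0ₚ {p}) ≡ 0
    toℕ-0ₚ = trans (toℕ-fromℕ< _) (m<n⇒m%n≡m (>-nonZero⁻¹ p))

    %-absorbˡ : ∀ m n → (m % p + n) % p ≡ (m + n) % p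
    %-absorbˡ m n = begin
      (m % p + n) % p           ≡⟨ %-distribˡ-+ (m % p) n p ⟩
      (m % p % p + n % p) % p   ≡⟨ cong (λ t → (t + n % p) % p) (m%n%n≡m%n m p) ⟩
      (m % p + n % p) % p       ≡⟨ %-distribˡ-+ m n p ⟨
      (m + n) % p               ∎
      where open ≡-Reasoning

  +ₚ-comm : (a b : Fin p) → a +ₚ b ≡ b +ₚ a
  +ₚ-comm a b = toℕ-injective (begin
    toℕ (a +ₚ b)             ≡⟨ toℕ-+ₚ a b ⟩
    (toℕ a + toℕ b) % p      ≡⟨ cong (_% p) (+-comm (toℕ a) (toℕ b)) ⟩
    (toℕ b + toℕ a) % p      ≡⟨ toℕ-+ₚ b a ⟨
    toℕ (b +ₚ a)             ∎)
    where open ≡-Reasoning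

  +ₚ-assoc : (a b c : Fin p) → (a +ₚ b) +ₚ c ≡ a +ₚ (b +ₚ c)
  +ₚ-assoc a b c = toℕ-injective (begin
    toℕ ((a +ₚ b) +ₚ c)                 ≡⟨ toℕ-+ₚ (a +ₚ b) c ⟩
    (toℕ (a +ₚ b) + toℕ c) % p          ≡⟨ cong (λ t → (t + toℕ c) % p) (toℕ-+ₚ a b) ⟩
    ((toℕ a + toℕ b) % p + toℕ c) % p   ≡⟨ %-absorbˡ (toℕ a + toℕ b) (toℕ c) ⟩
    (toℕ a + toℕ b + toℕ c) % p         ≡⟨ cong (_% p) (+-assoc (toℕ a) (toℕ b) (toℕ c)) ⟩
    (toℕ a + (toℕ b + toℕ c)) % p       ≡⟨ cong (_% p) (+-comm (toℕ a) _) ⟩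
    (toℕ b + toℕ c + toℕ a) % p         ≡⟨ %-absorbˡ (toℕ b + toℕ c) (toℕ a) ⟨
    ((toℕ b + toℕ c) % p + toℕ a) % p   ≡⟨ cong (λ t → (t + toℕ a) % p) (toℕ-+ₚ b c) ⟨
    (toℕ (b +ₚ c) + toℕ a) % p          ≡⟨ cong (_% p) (+-comm _ (toℕ a)) ⟩
    (toℕ a + toℕ (b +ₚ c)) % p          ≡⟨ toℕ-+ₚ a (b +ₚ c) ⟨
    toℕ (a +ₚ (b +ₚ c))                 ∎)
    where open ≡-Reasoning

  +ₚ-identityʳ : (a : Fin p) → a +ₚ 0ₚ ≡ a
  +ₚ-identityʳ a = toℕ-injective (begin
    toℕ (a +ₚ 0ₚ)             ≡⟨ toℕ-+ₚ a 0ₚ ⟩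
    (toℕ a + toℕ (0ₚ {p})) % p ≡⟨ cong (λ t → (toℕ a + t) % p) toℕ-0ₚ ⟩
    (toℕ a + 0) % p           ≡⟨ cong (_% p) (+-identityʳ (toℕ a)) ⟩
    toℕ a % p                 ≡⟨ m<n⇒m%n≡m (toℕ<n a) ⟩
    toℕ a                     ∎)
    where open ≡-Reasoning

  +ₚ-inverseʳ : (a : Fin p) → a +ₚ (-ₚ a) ≡ 0ₚ
  +ₚ-inverseʳ a = toℕ-injective (begin
    toℕ (a +ₚ (-ₚ a))                 ≡⟨ toℕ-+ₚ a (-ₚ a) ⟩
    (toℕ a + toℕ (-ₚ a)) % p          ≡⟨ cong (λ t → (toℕ a + t) % p) (toℕ-fromℕ< _) ⟩
    (toℕ a + (p ∸ toℕ a) % p) % p     ≡⟨ cong (_% p) (+-comm (toℕ a) _) ⟩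
    ((p ∸ toℕ a) % p + toℕ a) % p     ≡⟨ %-absorbˡ (p ∸ toℕ a) (toℕ a) ⟩
    (p ∸ toℕ a + toℕ a) % p           ≡⟨ cong (_% p) (m∸n+n≡m (<⇒≤ (toℕ<n a))) ⟩
    p % p                             ≡⟨ n%n≡0 p ⟩
    0                                 ≡⟨ toℕ-0ₚ ⟨
    toℕ (0ₚ {p})                      ∎)
    where open ≡-Reasoning

  ℤₚ : FiniteAbelianGroup
  ℤₚ = record
    { Carrier         = Fin p
    ; _∙_             = _+ₚ_
    ; ε               = 0ₚ
    ; _⁻¹             = -ₚ_
    ; isAbelianGroup  = comm∧assoc∧idʳ∧invʳ⇒isAbelianGroup +ₚ-comm +ₚ-assoc +ₚ-identityʳ +ₚ-inverseʳ
    ; _≟_             = Fin._≟_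
    ; elements        = allFin p
    ; ∈-elements      = ∈-allFin
    ; elements-unique = Unique.allFin⁺ p
    }

  open FiniteAbelianGroup ℤₚ using (_×ᵍ_; HasNoOrderBelow)

  toℕ-×ᵍ : ∀ n a → toℕ (n ×ᵍ a) ≡ (n * toℕ a) % p
  toℕ-×ᵍ zero    a = toℕ-fromℕ< _
  toℕ-×ᵍ (suc n) a = begin
    toℕ (a +ₚ n ×ᵍ a)                    ≡⟨ toℕ-+ₚ a (n ×ᵍ a) ⟩
    (toℕ a + toℕ (n ×ᵍ a)) % p           ≡⟨ cong (λ t → (toℕ a + t) % p) (toℕ-×ᵍ n a) ⟩
    (toℕ a + (n * toℕ a) % p) % p        ≡⟨ cong (_% p) (+-comm (toℕ a) _) ⟩
    ((n * toℕ a) % p + toℕ a) % p        ≡⟨ %-absorbˡ (n * toℕ a) (toℕ a) ⟩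
    (n * toℕ a + toℕ a) % p              ≡⟨ cong (_% p) (+-comm (n * toℕ a) (toℕ a)) ⟩
    (suc n * toℕ a) % p                  ∎
    where open ≡-Reasoning

  ℤₚ-hasNoOrderBelow : Prime p → HasNoOrderBelow p
  ℤₚ-hasNoOrderBelow p-prime n a 0<n n<p n×a≡0 = toℕ-injective (trans toℕa≡0 (sym toℕ-0ₚ))
    where
    p∣n*a : p ∣ n * toℕ a
    p∣n*a = m%n≡0⇒n∣m _ p (trans (sym (toℕ-×ᵍ n a)) (trans (cong toℕ n×a≡0) toℕ-0ₚ))
    toℕa≡0 : toℕ a ≡ 0
    toℕa≡0 with euclidsLemma n (toℕ a) p-prime p∣n*a
    ... | inj₁ p∣n = ⊥-elim (<⇒≱ n<p (∣⇒≤ {{>-nonZero 0<n}} p∣n))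
    ... | inj₂ p∣a with toℕ a in toℕa≡
    ...   | zero  = refl
    ...   | suc _ = ⊥-elim (<⇒≱ (subst (_< p) toℕa≡ (toℕ<n a)) (∣⇒≤ p∣a))

-- its operation is definitionally the _⊕_ of G p
ℤₚ² : (p : ℕ) .{{_ : NonZero p}} → FiniteAbelianGroup
ℤₚ² p = ℤₚ {p} ⊗ ℤₚ


module PairSums (𝔹 : FiniteAbelianGroup) (noOrderBelow-4 : FiniteAbelianGroup.HasNoOrderBelow 𝔹 4) where

  open import Data.List.Relation.Unary.All using ([]; _∷_)
  open AllPairs using ([]; _∷_)

  open FiniteAbelianGroup 𝔹

  record PairSumOutside (i j l : Carrier) : Set where
    field
      x y z   : Carrier
      xyz↭ijl : x ∷ y ∷ z ∷ [] ↭ i ∷ j ∷ l ∷ []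
      distinct : Unique (ε ∷ x ∙ y ∷ x ∷ y ∷ z ∷ [])

  private
    Unique-resp-↭ : ∀ {xs ys} → xs ↭ ys → Unique xs → Unique ys
    Unique-resp-↭ xs↭ys = PermutationSetoid.Unique-resp-↭ (setoid Carrier) (↭⇒↭ₛ xs↭ys)

    noOrderBelow-3 : HasNoOrderBelow 3
    noOrderBelow-3 = hasNoOrderBelow-mono (n≤1+n 3) noOrderBelow-4

    x∙x≡ε⇒x≡ε : ∀ {x} → x ∙ x ≡ ε → x ≡ ε
    x∙x≡ε⇒x≡ε x∙x≡ε = x∙x≡y∙y⇒x≡y noOrderBelow-3 (trans x∙x≡ε (sym (identityʳ ε)))

    x∙x∙x≡ε⇒x≡ε : ∀ {x} → x ∙ (x ∙ x) ≡ ε → x ≡ ε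
    x∙x∙x≡ε⇒x≡ε {x} x∙x∙x≡ε = noOrderBelow-4 3 x (s≤s z≤n) (s≤s (s≤s (s≤s (s≤s z≤n))))
      (trans (cong (λ t → x ∙ (x ∙ t)) (identityʳ x)) x∙x∙x≡ε)

    x∙y≢x : ∀ {x y} → y ≢ ε → x ∙ y ≢ x
    x∙y≢x {x} {y} y≢ε x∙y≡x = y≢ε (∙-cancelˡ x y ε (trans x∙y≡x (sym (identityʳ x))))

    x∙y≢y : ∀ {x y} → x ≢ ε → x ∙ y ≢ y
    x∙y≢y {x} {y} x≢ε x∙y≡y = x≢ε (∙-cancelʳ y x ε (trans x∙y≡y (sym (identityˡ y))))

    outside : ∀ {i j l x y z} → Unique (ε ∷ i ∷ j ∷ l ∷ []) → x ∷ y ∷ z ∷ [] ↭ i ∷ j ∷ l ∷ [] →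
              x ∙ y ≢ ε → x ∙ y ≢ z → PairSumOutside i j l
    outside {x = x} {y} {z} εijl! xyz↭ijl x∙y≢ε x∙y≢z
      with Unique-resp-↭ (↭-sym (↭-prep ε xyz↭ijl)) εijl!
    ... | (ε≢x ∷ ε≢y ∷ ε≢z ∷ []) ∷ xyz! = record
      { xyz↭ijl = xyz↭ijl
      ; distinct = (≢-sym x∙y≢ε ∷ ε≢x ∷ ε≢y ∷ ε≢z ∷ [])
                 ∷ (x∙y≢x (≢-sym ε≢y) ∷ x∙y≢y (≢-sym ε≢x) ∷ x∙y≢z ∷ [])
                 ∷ xyz!
      }

    -- (a ∙ c) ∙ (b ∙ c) = b ∙ a, so c ∙ c = ε
    swapped-by : ∀ {a b c} → a ∙ c ≡ b → b ∙ c ≡ a → c ≡ ε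
    swapped-by {a} {b} {c} a∙c≡b b∙c≡a = x∙x≡ε⇒x≡ε (∙-cancelˡ (a ∙ b) _ _ (begin
        (a ∙ b) ∙ (c ∙ c)   ≡⟨ comm∧assoc⇒middleFour comm assoc a b c c ⟩
        (a ∙ c) ∙ (b ∙ c)   ≡⟨ cong₂ _∙_ a∙c≡b b∙c≡a ⟩
        b ∙ a               ≡⟨ comm b a ⟩
        a ∙ b               ≡⟨ identityʳ (a ∙ b) ⟨
        (a ∙ b) ∙ ε         ∎))
      where open ≡-Reasoning

  -- at most one of i ∙ j, i ∙ l, j ∙ l is ε, and no two of them equal the remaining element
  pairSumOutside : ∀ {i j l} → Unique (ε ∷ i ∷ j ∷ l ∷ []) → PairSumOutside i j l
  pairSumOutside {i} {j} {l} εijl!@((ε≢i ∷ ε≢j ∷ ε≢l ∷ []) ∷ (i≢j ∷ i≢l ∷ []) ∷ (j≢l ∷ []) ∷ [] ∷ [])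
    with i ∙ j ≟ ε | i ∙ j ≟ l | i ∙ l ≟ ε | i ∙ l ≟ j | j ∙ l ≟ ε | j ∙ l ≟ i
  ... | no i∙j≢ε | no i∙j≢l | _ | _ | _ | _ = outside εijl! ↭-refl i∙j≢ε i∙j≢l
  ... | _ | _ | no i∙l≢ε | no i∙l≢j | _ | _ = outside εijl! (↭-prep i (↭-swap l j ↭-refl)) i∙l≢ε i∙l≢j
  ... | _ | _ | _ | _ | no j∙l≢ε | no j∙l≢i =
    outside εijl! (↭-trans (↭-prep j (↭-swap l i ↭-refl)) (↭-swap j i ↭-refl)) j∙l≢ε j∙l≢i
  ... | yes i∙j≡ε | _ | yes i∙l≡ε | _ | _ | _ = ⊥-elim (j≢l (∙-cancelˡ i j l (trans i∙j≡ε (sym i∙l≡ε))))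
  ... | yes i∙j≡ε | _ | _ | _ | yes j∙l≡ε | _ =
    ⊥-elim (i≢l (∙-cancelʳ j i l (trans i∙j≡ε (sym (trans (comm l j) j∙l≡ε)))))
  ... | _ | _ | yes i∙l≡ε | _ | yes j∙l≡ε | _ = ⊥-elim (i≢j (∙-cancelʳ l i j (trans i∙l≡ε (sym j∙l≡ε))))
  ... | _ | yes i∙j≡l | _ | yes i∙l≡j | _ | _ = ⊥-elim (ε≢i (sym (swapped-by (trans (comm j i) i∙j≡l) (trans (comm l i) i∙l≡j))))
  ... | _ | yes i∙j≡l | _ | _ | _ | yes j∙l≡i = ⊥-elim (ε≢j (sym (swapped-by i∙j≡l (trans (comm l j) j∙l≡i))))
  ... | _ | _ | _ | yes i∙l≡j | _ | yes j∙l≡i = ⊥-elim (ε≢l (sym (swapped-by i∙l≡j j∙l≡i)))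

  distinct-with-sum : ∀ {i j} → Unique (ε ∷ i ∷ j ∷ []) → i ∙ j ≢ ε → Unique (ε ∷ i ∷ j ∷ i ∙ j ∷ [])
  distinct-with-sum {i} {j} ((ε≢i ∷ ε≢j ∷ []) ∷ (i≢j ∷ []) ∷ [] ∷ []) i∙j≢ε =
    (ε≢i ∷ ε≢j ∷ ≢-sym i∙j≢ε ∷ []) ∷ (i≢j ∷ ≢-sym (x∙y≢x (≢-sym ε≢j)) ∷ []) ∷ (≢-sym (x∙y≢y (≢-sym ε≢i)) ∷ []) ∷ [] ∷ []

  -- with i ∙ j = ε, i = j ∙ j would give j ∙ (j ∙ j) = ε
  distinct-with-doubles : ∀ {i j} → Unique (ε ∷ i ∷ j ∷ []) → i ∙ j ≡ ε → Unique (ε ∷ i ∷ j ∷ i ∙ i ∷ j ∙ j ∷ [])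
  distinct-with-doubles {i} {j} ((ε≢i ∷ ε≢j ∷ []) ∷ (i≢j ∷ []) ∷ [] ∷ []) i∙j≡ε =
    (ε≢i ∷ ε≢j ∷ ≢-sym (i≢ε ∘ x∙x≡ε⇒x≡ε) ∷ ≢-sym (j≢ε ∘ x∙x≡ε⇒x≡ε) ∷ []) ∷
    (i≢j ∷ ≢-sym (x∙y≢x i≢ε) ∷ i≢j∙j ∷ []) ∷
    (j≢i∙i ∷ ≢-sym (x∙y≢x j≢ε) ∷ []) ∷
    ((i≢j ∘ x∙x≡y∙y⇒x≡y noOrderBelow-3) ∷ []) ∷ [] ∷ []
    where
    i≢ε : i ≢ ε
    i≢ε = ≢-sym ε≢i
    j≢ε : j ≢ ε
    j≢ε = ≢-sym ε≢j
    i≢j∙j : i ≢ j ∙ j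
    i≢j∙j i≡j∙j = j≢ε (x∙x∙x≡ε⇒x≡ε (trans (cong (j ∙_) (sym i≡j∙j)) (trans (comm j i) i∙j≡ε)))
    j≢i∙i : j ≢ i ∙ i
    j≢i∙i j≡i∙i = i≢ε (x∙x∙x≡ε⇒x≡ε (trans (cong (i ∙_) (sym j≡i∙i)) i∙j≡ε))

module LinearArithmetic where

  -- G₁ ≤ G₂ from a sum L ≤ R of known inequalities, L and R being G₁ and G₂ plus a common summand Z
  cancel-common : ∀ {L R G₁ G₂} Z → L ≤ R → L ≡ G₁ + Z → R ≡ G₂ + Z → G₁ ≤ G₂
  cancel-common {G₁ = G₁} {G₂} Z L≤R refl refl = +-cancelʳ-≤ Z G₁ G₂ L≤R

  infixr 5 _⊹_
  _⊹_ : ∀ {a b c d} → a ≤ b → c ≤ d → a + c ≤ b + d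
  _⊹_ = +-mono-≤

  -- kept opaque: Agda would otherwise unfold the large solver-generated proofs while checking their uses
  opaque
    2p,2p⇒3p : ∀ p {F₁ F₂} r → 2 * p ≤ F₁ → 2 * p ≤ F₂ → 3 * p ≤ F₁ + (F₂ + r)
    2p,2p⇒3p p {F₁} {F₂} r 2p≤F₁ 2p≤F₂ =
      cancel-common p (2p≤F₁ ⊹ 2p≤F₂ ⊹ z≤n {r} ⊹ z≤n {p}) (solve (p ∷ [])) (solve (F₁ ∷ F₂ ∷ r ∷ p ∷ []))

    2p,p⇒3p : ∀ p {B F₁ F₂} r → 2 * p ≤ F₁ → B + p ≤ suc F₂ → 1 ≤ B → 3 * p ≤ F₁ + (F₂ + r)
    2p,p⇒3p p {B} {F₁} {F₂} r 2p≤F₁ B+p≤1+F₂ 1≤B =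
      cancel-common (B + 1) (2p≤F₁ ⊹ B+p≤1+F₂ ⊹ 1≤B ⊹ z≤n {r}) (solve (p ∷ B ∷ [])) (solve (F₁ ∷ F₂ ∷ r ∷ B ∷ []))

    p,2p⇒3p : ∀ p {A F₁ F₂} r → A + p ≤ suc F₁ → 1 ≤ A → 2 * p ≤ F₂ → 3 * p ≤ F₁ + (F₂ + r)
    p,2p⇒3p p {A} {F₁} {F₂} r A+p≤1+F₁ 1≤A 2p≤F₂ =
      cancel-common (A + 1) (A+p≤1+F₁ ⊹ 1≤A ⊹ 2p≤F₂ ⊹ z≤n {r}) (solve (p ∷ A ∷ [])) (solve (F₁ ∷ F₂ ∷ r ∷ A ∷ []))

    p,p⇒3p : ∀ p k {A B r F₁ F₂ r′} → A + p ≤ suc F₁ → B + p ≤ suc F₂ → r ≤ r′ →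
             2 * p + 1 ≤ k + (A + (B + r)) → k < p → 3 * p ≤ F₁ + (F₂ + r′)
    p,p⇒3p p k {A} {B} {r} {F₁} {F₂} {r′} A+p≤1+F₁ B+p≤1+F₂ r≤r′ 2p+1≤k+Σ k<p =
      cancel-common (k + A + B + r + p + 2) (A+p≤1+F₁ ⊹ B+p≤1+F₂ ⊹ r≤r′ ⊹ 2p+1≤k+Σ ⊹ k<p) lhs rhs
      where
      lhs : A + p + (B + p + (r + (2 * p + 1 + suc k))) ≡ 3 * p + (k + A + B + r + p + 2)
      lhs = solve (p ∷ k ∷ A ∷ B ∷ r ∷ [])
      rhs : suc F₁ + (suc F₂ + (r′ + (k + (A + (B + r)) + p))) ≡ F₁ + (F₂ + r′) + (k + A + B + r + p + 2)
      rhs = solve (p ∷ k ∷ A ∷ B ∷ r ∷ F₁ ∷ F₂ ∷ r′ ∷ [])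

    -- Three slices x, y, z and a fifth coset carrying e restricted sums.  In the hypotheses
    -- p ≤ f marks a saturated slice, k + a ≤ suc f an unsaturated one.
    sss : ∀ {p fx fy fz} e → p ≤ fx → p ≤ fy → p ≤ fz → 3 * p ≤ e + (fx + (fy + (fz + 0)))
    sss {p} {fx} {fy} {fz} e p≤fx p≤fy p≤fz =
      cancel-common 0 (z≤n {e} ⊹ p≤fx ⊹ p≤fy ⊹ p≤fz ⊹ z≤n {0}) (solve (p ∷ [])) (solve (e ∷ fx ∷ fy ∷ fz ∷ []))

    ssu : ∀ p k {ax ay az fx fy fz e} → p ≤ fx → p ≤ fy → k + az ≤ suc fz → ax ≤ e → ay ≤ p →
      2 * p + 1 ≤ k + (ax + (ay + (az + 0))) → 3 * p ≤ e + (fx + (fy + (fz + 0)))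
    ssu p k {ax} {ay} {az} {fx} {fy} {fz} {e} p≤fx p≤fy k+az≤1+fz ax≤e ay≤p S =
      cancel-common (k + ax + ay + az + p + 1) (p≤fx ⊹ p≤fy ⊹ k+az≤1+fz ⊹ ax≤e ⊹ ay≤p ⊹ S) (solve (p ∷ k ∷ ax ∷ ay ∷ az ∷ [])) (solve (p ∷ k ∷ ax ∷ ay ∷ az ∷ fx ∷ fy ∷ fz ∷ e ∷ []))

    uss : ∀ p k {ax ay az fx fy fz e} → k + ax ≤ suc fx → p ≤ fy → p ≤ fz → ay ≤ e → az ≤ p →
      2 * p + 1 ≤ k + (ax + (ay + (az + 0))) → 3 * p ≤ e + (fx + (fy + (fz + 0)))
    uss p k {ax} {ay} {az} {fx} {fy} {fz} {e} k+ax≤1+fx p≤fy p≤fz ay≤e az≤p S =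
      cancel-common (k + ax + ay + az + p + 1) (k+ax≤1+fx ⊹ p≤fy ⊹ p≤fz ⊹ ay≤e ⊹ az≤p ⊹ S) (solve (p ∷ k ∷ ax ∷ ay ∷ az ∷ [])) (solve (p ∷ k ∷ ax ∷ ay ∷ az ∷ fx ∷ fy ∷ fz ∷ e ∷ []))

    sus : ∀ p k {ax ay az fx fy fz e} → p ≤ fx → k + ay ≤ suc fy → p ≤ fz → ax ≤ e → az ≤ p →
      2 * p + 1 ≤ k + (ax + (ay + (az + 0))) → 3 * p ≤ e + (fx + (fy + (fz + 0)))
    sus p k {ax} {ay} {az} {fx} {fy} {fz} {e} p≤fx k+ay≤1+fy p≤fz ax≤e az≤p S =
      cancel-common (k + ax + ay + az + p + 1) (p≤fx ⊹ k+ay≤1+fy ⊹ p≤fz ⊹ ax≤e ⊹ az≤p ⊹ S) (solve (p ∷ k ∷ ax ∷ ay ∷ az ∷ [])) (solve (p ∷ k ∷ ax ∷ ay ∷ az ∷ fx ∷ fy ∷ fz ∷ e ∷ []))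

    uu* : ∀ p k {ax ay az fx fy fz e} → k + ax ≤ suc fx → k + ay ≤ suc fy → az + p ≤ fz + k → 1 ≤ e →
      2 * p + 1 ≤ k + (ax + (ay + (az + 0))) → 3 * p ≤ e + (fx + (fy + (fz + 0)))
    uu* p k {ax} {ay} {az} {fx} {fy} {fz} {e} k+ax≤1+fx k+ay≤1+fy az+p≤fz+k 1≤e S =
      cancel-common (k + k + ax + ay + az + 2) (k+ax≤1+fx ⊹ k+ay≤1+fy ⊹ az+p≤fz+k ⊹ 1≤e ⊹ S) (solve (p ∷ k ∷ ax ∷ ay ∷ az ∷ [])) (solve (p ∷ k ∷ ax ∷ ay ∷ az ∷ fx ∷ fy ∷ fz ∷ e ∷ []))

    u*u : ∀ p k {ax ay az fx fy fz e} → k + ax ≤ suc fx → ay + p ≤ fy + k → k + az ≤ suc fz → 1 ≤ e →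
      2 * p + 1 ≤ k + (ax + (ay + (az + 0))) → 3 * p ≤ e + (fx + (fy + (fz + 0)))
    u*u p k {ax} {ay} {az} {fx} {fy} {fz} {e} k+ax≤1+fx ay+p≤fy+k k+az≤1+fz 1≤e S =
      cancel-common (k + k + ax + ay + az + 2) (k+ax≤1+fx ⊹ ay+p≤fy+k ⊹ k+az≤1+fz ⊹ 1≤e ⊹ S) (solve (p ∷ k ∷ ax ∷ ay ∷ az ∷ [])) (solve (p ∷ k ∷ ax ∷ ay ∷ az ∷ fx ∷ fy ∷ fz ∷ e ∷ []))

    *uu : ∀ p k {ax ay az fx fy fz e} → ax + p ≤ fx + k → k + ay ≤ suc fy → k + az ≤ suc fz → 1 ≤ e →
      2 * p + 1 ≤ k + (ax + (ay + (az + 0))) → 3 * p ≤ e + (fx + (fy + (fz + 0)))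
    *uu p k {ax} {ay} {az} {fx} {fy} {fz} {e} ax+p≤fx+k k+ay≤1+fy k+az≤1+fz 1≤e S =
      cancel-common (k + k + ax + ay + az + 2) (ax+p≤fx+k ⊹ k+ay≤1+fy ⊹ k+az≤1+fz ⊹ 1≤e ⊹ S) (solve (p ∷ k ∷ ax ∷ ay ∷ az ∷ [])) (solve (p ∷ k ∷ ax ∷ ay ∷ az ∷ fx ∷ fy ∷ fz ∷ e ∷ []))

    p+1≤k+a₁ : ∀ p k a₁ a₂ → 2 * p + 1 ≤ k + (a₁ + (a₂ + 0)) → a₂ ≤ p → p + 1 ≤ k + a₁
    p+1≤k+a₁ p k a₁ a₂ S a₂≤p = cancel-common (p + a₂) (S ⊹ a₂≤p) (solve (p ∷ a₂ ∷ [])) (solve (p ∷ k ∷ a₁ ∷ a₂ ∷ []))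

    p+1≤k+a₂ : ∀ p k a₁ a₂ → 2 * p + 1 ≤ k + (a₁ + (a₂ + 0)) → a₁ ≤ p → p + 1 ≤ k + a₂
    p+1≤k+a₂ p k a₁ a₂ S a₁≤p = cancel-common (p + a₁) (S ⊹ a₁≤p) (solve (p ∷ a₁ ∷ [])) (solve (p ∷ k ∷ a₁ ∷ a₂ ∷ []))

    p<a₁+a₂ : ∀ p k a₁ a₂ → 2 * p + 1 ≤ k + (a₁ + (a₂ + 0)) → k ≤ p → p < a₁ + a₂
    p<a₁+a₂ p k a₁ a₂ S k≤p = cancel-common (p + k) (S ⊹ k≤p) (solve (p ∷ k ∷ [])) (solve (p ∷ k ∷ a₁ ∷ a₂ ∷ []))

    p+2≤2a₂ : ∀ p a₁ a₂ → p < a₁ + a₂ → a₁ ≤ 2 → 4 ≤ p → p + 2 ≤ 2 * a₂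
    p+2≤2a₂ p a₁ a₂ p<a₁+a₂ a₁≤2 4≤p =
      cancel-common (p + a₁ + a₁ + 4) (p<a₁+a₂ ⊹ p<a₁+a₂ ⊹ a₁≤2 ⊹ a₁≤2 ⊹ 4≤p)
        (solve (p ∷ a₁ ∷ [])) (solve (p ∷ a₁ ∷ a₂ ∷ []))

    p,p,p⇒3p : ∀ p x y z → p ≤ x → p ≤ y → p ≤ z → 3 * p ≤ x + (y + (z + 0))
    p,p,p⇒3p p x y z p≤x p≤y p≤z =
      cancel-common 0 (p≤x ⊹ p≤y ⊹ p≤z) (solve (p ∷ [])) (solve (x ∷ y ∷ z ∷ []))

    p,p,p+⇒3p : ∀ p x y z w → p ≤ x → p ≤ y → p ≤ z + w → 3 * p ≤ x + (y + (z + (w + 0)))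
    p,p,p+⇒3p p x y z w p≤x p≤y p≤z+w =
      cancel-common 0 (p≤x ⊹ p≤y ⊹ p≤z+w) (solve (p ∷ [])) (solve (x ∷ y ∷ z ∷ w ∷ []))

open LinearArithmetic

module Estimates (p k : ℕ) (k≤p : k ≤ p) (p+3≤k+k : p + 3 ≤ k + k) where

  -- Abstracts a slice A_c ≠ A₀ with a = ∣A_c∣ and f = ∣2^A ∩ H_c∣ ≥ ∣A₀ + A_c∣, where k = ∣A₀∣;
  -- bound is the Cauchy–Davenport bound for A₀ + A_c.  The slice is saturated when p ≤ f.
  record Estimate (a f : ℕ) : Set where
    field
      1≤a : 1 ≤ a
      a≤k : a ≤ k
      bound : p ≤ f ⊎ k + a ≤ suc f

  open Estimate public

  p+1≤k+k : p + 1 ≤ k + k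
  p+1≤k+k = ≤-trans (+-monoʳ-≤ p (s≤s {n = 2} z≤n)) p+3≤k+k

  module _ {a f} (e : Estimate a f) where

    a≤p : a ≤ p
    a≤p = ≤-trans (a≤k e) k≤p

    a+p≤f+k : a + p ≤ f + k
    a+p≤f+k with bound e
    ... | inj₁ p≤f = subst (_≤ f + k) (+-comm p a) (p≤f ⊹ a≤k e)
    ... | inj₂ k+a≤1+f = cancel-common (k + 1) (k+a≤1+f ⊹ p+1≤k+k) (solve (a ∷ p ∷ k ∷ [])) (solve (f ∷ k ∷ []))

    unsaturated : f < p → k + a ≤ suc f
    unsaturated f<p with bound e
    ... | inj₁ p≤f = contradiction p≤f (<⇒≱ f<p)
    ... | inj₂ k+a≤1+f = k+a≤1+f

    saturated : p + 1 ≤ k + a → p ≤ f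
    saturated p+1≤k+a with bound e
    ... | inj₁ p≤f = p≤f
    ... | inj₂ k+a≤1+f = s≤s⁻¹ (subst (_≤ suc f) (+-comm p 1) (≤-trans p+1≤k+a k+a≤1+f))

    unsaturated⇒k<p : f < p → k < p
    unsaturated⇒k<p f<p = subst (_≤ p) (+-comm k 1) (≤-trans (+-monoʳ-≤ k (1≤a e)) (≤-trans (unsaturated f<p) f<p))

  PairBound : ℕ → ℕ → Set
  PairBound A F = 2 * p ≤ F ⊎ (A + p ≤ suc F × k < p)

  pair-bound : ∀ {a f a′ f′} → Estimate a f → Estimate a′ f′ → PairBound (a + a′) (f + f′)
  pair-bound {a} {f} {a′} {f′} e e′ with p ≤? f | p ≤? f′
  ... | yes p≤f | yes p≤f′ = inj₁ (subst (_≤ f + f′) (cong (p +_) (sym (+-identityʳ p))) (p≤f ⊹ p≤f′))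
  ... | no p≰f | _ = inj₂ (cancel-common k (unsaturated e (≰⇒> p≰f) ⊹ a+p≤f+k e′)
                             (solve (a ∷ a′ ∷ p ∷ k ∷ [])) (solve (f ∷ f′ ∷ k ∷ [])) , unsaturated⇒k<p e (≰⇒> p≰f))
  ... | yes _ | no p≰f′ = inj₂ (cancel-common k (a+p≤f+k e ⊹ unsaturated e′ (≰⇒> p≰f′))
                             (solve (a ∷ a′ ∷ p ∷ k ∷ [])) (solve (f ∷ f′ ∷ k ∷ [])) , unsaturated⇒k<p e′ (≰⇒> p≰f′))

  two-pairs : ∀ {A B F₁ F₂ r r′} → PairBound A F₁ → PairBound B F₂ → 1 ≤ A → 1 ≤ B → r ≤ r′ →
             2 * p + 1 ≤ k + (A + (B + r)) → 3 * p ≤ F₁ + (F₂ + r′)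
  two-pairs {r′ = r′} (inj₁ 2p≤F₁) (inj₁ 2p≤F₂) _ _ _ _ = 2p,2p⇒3p p r′ 2p≤F₁ 2p≤F₂
  two-pairs {r′ = r′} (inj₁ 2p≤F₁) (inj₂ (B+p≤1+F₂ , _)) _ 1≤B _ _ = 2p,p⇒3p p r′ 2p≤F₁ B+p≤1+F₂ 1≤B
  two-pairs {r′ = r′} (inj₂ (A+p≤1+F₁ , _)) (inj₁ 2p≤F₂) 1≤A _ _ _ = p,2p⇒3p p r′ A+p≤1+F₁ 1≤A 2p≤F₂
  two-pairs (inj₂ (A+p≤1+F₁ , _)) (inj₂ (B+p≤1+F₂ , k<p)) _ _ r≤r′ 2p+1≤k+Σ = p,p⇒3p p k A+p≤1+F₁ B+p≤1+F₂ r≤r′ 2p+1≤k+Σ k<p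

  regroup : ∀ w x y z r → w + (x + (y + (z + r))) ≡ (w + x) + ((y + z) + r)
  regroup = solve-∀

  four-or-more-slices : ∀ {a₁ a₂ a₃ a₄ f₁ f₂ f₃ f₄ r r′} →
    Estimate a₁ f₁ → Estimate a₂ f₂ → Estimate a₃ f₃ → Estimate a₄ f₄ → r ≤ r′ →
    2 * p + 1 ≤ k + (a₁ + (a₂ + (a₃ + (a₄ + r)))) → 3 * p ≤ f₁ + (f₂ + (f₃ + (f₄ + r′)))
  four-or-more-slices {a₁} {a₂} {a₃} {a₄} {f₁} {f₂} {f₃} {f₄} {r} {r′} e₁ e₂ e₃ e₄ r≤r′ 2p+1≤k+Σa =
    subst (3 * p ≤_) (sym (regroup f₁ f₂ f₃ f₄ r′))
      (two-pairs (pair-bound e₁ e₂) (pair-bound e₃ e₄) (≤-trans (1≤a e₁) (m≤m+n a₁ a₂)) (≤-trans (1≤a e₃) (m≤m+n a₃ a₄))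
                r≤r′ (subst (λ t → 2 * p + 1 ≤ k + t) (regroup a₁ a₂ a₃ a₄ r) 2p+1≤k+Σa))

  three-slices : ∀ {ax ay az fx fy fz e} → Estimate ax fx → Estimate ay fy → Estimate az fz → ax ≤ e → ay ≤ e →
    2 * p + 1 ≤ k + (ax + (ay + (az + 0))) → 3 * p ≤ e + (fx + (fy + (fz + 0)))
  three-slices {fx = fx} {fy} {fz} {e} ex ey ez ax≤e ay≤e S with p ≤? fx | p ≤? fy | p ≤? fz
  ... | yes p≤fx | yes p≤fy | yes p≤fz = sss e p≤fx p≤fy p≤fz
  ... | yes p≤fx | yes p≤fy | no p≰fz = ssu p k p≤fx p≤fy (unsaturated ez (≰⇒> p≰fz)) ax≤e (a≤p ey) S
  ... | no p≰fx | yes p≤fy | yes p≤fz = uss p k (unsaturated ex (≰⇒> p≰fx)) p≤fy p≤fz ay≤e (a≤p ez) S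
  ... | yes p≤fx | no p≰fy | yes p≤fz = sus p k p≤fx (unsaturated ey (≰⇒> p≰fy)) p≤fz ax≤e (a≤p ez) S
  ... | no p≰fx | no p≰fy | _ =
    uu* p k (unsaturated ex (≰⇒> p≰fx)) (unsaturated ey (≰⇒> p≰fy)) (a+p≤f+k ez) (≤-trans (1≤a ex) ax≤e) S
  ... | no p≰fx | yes _ | no p≰fz =
    u*u p k (unsaturated ex (≰⇒> p≰fx)) (a+p≤f+k ey) (unsaturated ez (≰⇒> p≰fz)) (≤-trans (1≤a ex) ax≤e) S
  ... | yes _ | no p≰fy | no p≰fz =
    *uu p k (a+p≤f+k ex) (unsaturated ey (≰⇒> p≰fy)) (unsaturated ez (≰⇒> p≰fz)) (≤-trans (1≤a ex) ax≤e) S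

  a≤f : ∀ {a f} → Estimate a f → a ≤ f
  a≤f {a} {f} e = +-cancelʳ-≤ p a f (≤-trans (a+p≤f+k e) (+-monoʳ-≤ f k≤p))

  k+a≰2p : ∀ {a} → a ≤ k → 2 * p + 1 ≤ k + (a + 0) → ⊥
  k+a≰2p {a} a≤k S = <⇒≱ (m<m+n (2 * p) (s≤s z≤n)) (≤-trans S k+a≤2p)
    where
    k+a≤2p : k + (a + 0) ≤ 2 * p
    k+a≤2p = subst (k + (a + 0) ≤_) (cong (p +_) (sym (+-identityʳ p)))
               (k≤p ⊹ ≤-trans (≤-reflexive (+-identityʳ a)) (≤-trans a≤k k≤p))

module Lemma3p11 (p : ℕ) .{{_ : NonZero p}} (p-prime : Prime p) (5≤p : 5 ≤ p)
  (A : List (G p)) (A! : Unique A) (∣A∣≡2p+1 : length A ≡ 2 * p + 1)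
  (H : List (G p)) (H! : Unique H) (∣H∣≡p : length H ≡ p)
  (idx : G p → Fin p) (idx-homo : ∀ x y → idx (x ⊕ y) ≡ idx x +ₚ idx y)
  (ker-idx : ∀ x → (idx x ≡ 0ₚ) ⇔ (x ∈ H))
  (A₀-largest : ∀ i → length (slice idx A i) ≤ length (slice idx A 0ₚ))
  (A₀-large : p + 3 ≤ 2 * length (slice idx A 0ₚ)) where

  open import Data.List.Relation.Unary.All using ([]; _∷_)
  open AllPairs using ([]; _∷_)

  open FiniteAbelianGroup (ℤₚ² p)
  open Sumsets (ℤₚ² p) p (⊗-hasNoOrderBelow ℤₚ ℤₚ (ℤₚ-hasNoOrderBelow p-prime) (ℤₚ-hasNoOrderBelow p-prime))
  open Fibres ℤₚ idx idx-homo
  open DecMembership _≟_ using (_∈?_)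

  4≤p : 4 ≤ p
  4≤p = ≤-trans (n≤1+n 4) 5≤p

  2<p : 2 < p
  2<p = ≤-trans (s≤s (s≤s (s≤s z≤n))) 5≤p

  𝒜 : Subset
  𝒜 x = ⌊ x ∈? A ⌋

  A[_] : Fin p → Subset
  A[ i ] = 𝒜 ∩ fibre i

  a f : Fin p → ℕ
  a i = ∣ A[ i ] ∣
  f i = ∣ 2^ 𝒜 ∩ fibre i ∣

  k : ℕ
  k = a 0ₚ

  ∣kernel∣≡p : ∣ kernel ∣ ≡ p
  ∣kernel∣≡p = trans (≤-antisym (∣∣≤length (λ x∈kernel → Equivalence.to (ker-idx _) (fibre⁻ x∈kernel)))
                                (length≤∣∣ H! (λ x∈H → fibre⁺ (Equivalence.from (ker-idx _) x∈H)))) ∣H∣≡p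

  a≡∣slice∣ : ∀ i → a i ≡ length (slice idx A i)
  a≡∣slice∣ i = ≤-antisym
    (∣∣≤length λ x∈A[i] → let (∈ₛ⁺ x∈𝒜 , x∈fibre) = ∩⁻ {𝒜} x∈A[i] in
      ∈-filter⁺ (λ x → idx x Fin.≟ i) (toWitness x∈𝒜) (fibre⁻ x∈fibre))
    (length≤∣∣ (Unique.filter⁺ (λ x → idx x Fin.≟ i) A!) λ {x} x∈slice →
      let (x∈A , idx-x≡i) = ∈-filter⁻ (λ x → idx x Fin.≟ i) {xs = A} x∈slice in
      ∩⁺ {𝒜} (∈ₛ⁺ (fromWitness x∈A)) (fibre⁺ idx-x≡i))

  ∣A∣≤∣𝒜∣ : length A ≤ ∣ 𝒜 ∣
  ∣A∣≤∣𝒜∣ = length≤∣∣ A! (λ x∈A → ∈ₛ⁺ (fromWitness x∈A))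

  ∣2^𝒜∣≤∣2^A∣ : ∣ 2^ 𝒜 ∣ ≤ length (restrictedSumset A)
  ∣2^𝒜∣≤∣2^A∣ = ∣∣≤length 2^𝒜⊆2^A
    where
    2^𝒜⊆2^A : ∀ {z} → z ∈ₛ 2^ 𝒜 → z ∈ restrictedSumset A
    2^𝒜⊆2^A z∈2^𝒜 =
      let (x , y , ∈ₛ⁺ x∈𝒜 , ∈ₛ⁺ y∈𝒜 , x≢y , z≡x∙y) = 2^⁻ {𝒜} z∈2^𝒜
      in subst (_∈ restrictedSumset A) (sym z≡x∙y) (∈-deduplicate⁺ _≟G_ (∈-concatMap⁺ sums-with {xs = A}
           (lose (toWitness {a? = x ∈? A} x∈𝒜)
                 (∈-map⁺ (x ⊕_) (∈-filter⁺ (λ y → ¬? (x ≟G y)) (toWitness {a? = y ∈? A} y∈𝒜) x≢y)))))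
      where
      sums-with : G p → List (G p)
      sums-with a₁ = map (a₁ ⊕_) (filter (λ a₂ → ¬? (a₁ ≟G a₂)) A)

  k≤p : k ≤ p
  k≤p = subst (k ≤_) ∣kernel∣≡p (∣∣-mono (λ x∈A[0] → proj₂ (∩⁻ {𝒜} x∈A[0])))

  p+3≤k+k : p + 3 ≤ k + k
  p+3≤k+k = subst (p + 3 ≤_) 2s≡k+k A₀-large
    where
    s : ℕ
    s = length (slice idx A 0ₚ)
    2s≡k+k : 2 * s ≡ k + k
    2s≡k+k = trans (cong (s +_) (+-identityʳ s)) (sym (cong₂ _+_ (a≡∣slice∣ 0ₚ) (a≡∣slice∣ 0ₚ)))

  a≤a₀ : ∀ i → a i ≤ k
  a≤a₀ i = subst₂ _≤_ (sym (a≡∣slice∣ i)) (sym (a≡∣slice∣ 0ₚ)) (A₀-largest i)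

  open Estimates p k k≤p p+3≤k+k

  1≤k : 1 ≤ k
  1≤k = ≤-trans (s≤s z≤n) (+-cancelˡ-≤ p 3 _ (≤-trans p+3≤k+k (+-monoˡ-≤ k k≤p)))

  A[]⊆fibre : ∀ i → A[ i ] ⊆ fibre i
  A[]⊆fibre i x∈A[i] = proj₂ (∩⁻ {𝒜} x∈A[i])

  ∣2^A[i]∣≤f : ∀ i → ∣ 2^ A[ i ] ∣ ≤ f (i +ₚ i)
  ∣2^A[i]∣≤f i = ∣∣-mono (2^⊆2^∩fibre {A[ i ]} (λ x∈ → x∈))

  ∣A[i]⊞A[j]∣≤f : ∀ {i j} → i ≢ j → ∣ A[ i ] ⊞ A[ j ] ∣ ≤ f (i +ₚ j)
  ∣A[i]⊞A[j]∣≤f {i} {j} i≢j = ∣∣-mono (⊞⊆2^∩fibre {A[ i ]} {A[ j ]} (λ x∈ → x∈) (λ x∈ → x∈) i≢j)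

  f₀ : p ≤ f 0ₚ
  f₀ = begin
    p                        ≡⟨ ∣kernel∣≡p ⟨
    ∣ kernel ∣               ≤⟨ ∣kernel∣≤∣2^X∣ 2<p (A[]⊆fibre 0ₚ) (proj₂ (nonempty {A[ 0ₚ ]} 1≤k)) ∣kernel∣+2≤2k ⟩
    ∣ 2^ A[ 0ₚ ] ∣           ≤⟨ ∣2^A[i]∣≤f 0ₚ ⟩
    f (0ₚ +ₚ 0ₚ)             ≡⟨ cong f (+ₚ-identityʳ 0ₚ) ⟩
    f 0ₚ                     ∎
    where
    open ≤-Reasoning
    ∣kernel∣+2≤2k : ∣ kernel ∣ + 2 ≤ 2 * k
    ∣kernel∣+2≤2k = subst₂ _≤_ (cong (_+ 2) (sym ∣kernel∣≡p)) (cong (k +_) (sym (+-identityʳ k)))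
                            (≤-trans (+-monoʳ-≤ p (n≤1+n 2)) p+3≤k+k)

  estimate : ∀ {c} → c ≢ 0ₚ → 1 ≤ a c → Estimate (a c) (f c)
  estimate {c} c≢0 1≤a = record { 1≤a = 1≤a ; a≤k = a≤a₀ c ; bound = cauchyDavenport-bound }
    where
    ∣A₀⊞A[c]∣≤f : ∣ A[ 0ₚ ] ⊞ A[ c ] ∣ ≤ f c
    ∣A₀⊞A[c]∣≤f = subst (λ i → ∣ A[ 0ₚ ] ⊞ A[ c ] ∣ ≤ f i) (FiniteAbelianGroup.identityˡ ℤₚ c) (∣A[i]⊞A[j]∣≤f (≢-sym c≢0))
    cauchyDavenport-bound : p ≤ f c ⊎ k + a c ≤ suc (f c)
    cauchyDavenport-bound with cauchyDavenport (proj₂ (nonempty {A[ 0ₚ ]} 1≤k)) (proj₂ (nonempty {A[ c ]} 1≤a))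
    ... | inj₁ p≤∣⊞∣ = inj₁ (≤-trans p≤∣⊞∣ ∣A₀⊞A[c]∣≤f)
    ... | inj₂ k+a≤ = inj₂ (≤-trans k+a≤ (s≤s ∣A₀⊞A[c]∣≤f))

  other-slice? : (c : Fin p) → Dec (c ≢ 0ₚ × 1 ≤ a c)
  other-slice? c = ¬? (c Fin.≟ 0ₚ) ×-dec (1 ≤? a c)

  support : List (Fin p)
  support = filter other-slice? (allFin p)

  in-support : ∀ {c} → c ∈ support → c ≢ 0ₚ × 1 ≤ a c
  in-support c∈support = proj₂ (∈-filter⁻ other-slice? {xs = allFin p} c∈support)

  0∷support! : Unique (0ₚ ∷ support)
  0∷support! = All.tabulate (≢-sym ∘ proj₁ ∘ in-support) ∷ Unique.filter⁺ other-slice? (Unique.allFin⁺ p)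

  support-estimates : All (λ c → Estimate (a c) (f c)) support
  support-estimates = All.tabulate λ c∈support → let (c≢0 , 1≤a) = in-support c∈support in estimate c≢0 1≤a

  2p+1≤k+Σa : 2 * p + 1 ≤ k + sum (map a support)
  2p+1≤k+Σa = subst (_≤ k + sum (map a support)) ∣A∣≡2p+1
                (≤-trans ∣A∣≤∣𝒜∣ (∣∣≤Σ∣∩fibre∣ 𝒜 (0ₚ ∷ support) idx∈0∷support))
    where
    idx∈0∷support : ∀ {x} → x ∈ₛ 𝒜 → idx x ∈ 0ₚ ∷ support
    idx∈0∷support {x} x∈𝒜 with idx x Fin.≟ 0ₚ
    ... | yes idx-x≡0 = here idx-x≡0
    ... | no idx-x≢0 = there (∈-filter⁺ other-slice? (∈-allFin (idx x))
                         (idx-x≢0 , ∣∣-pos {A[ idx x ]} (∩⁺ {𝒜} x∈𝒜 (fibre⁺ refl))))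

  open PairSums ℤₚ (FiniteAbelianGroup.hasNoOrderBelow-mono ℤₚ 4≤p (ℤₚ-hasNoOrderBelow p-prime))

  record Elsewhere : Set where
    field
      cosets    : List (Fin p)
      0∷cosets! : Unique (0ₚ ∷ cosets)
      3p≤Σf     : 3 * p ≤ sum (map f cosets)

  4p≤∣2^𝒜∣ : Elsewhere → 4 * p ≤ ∣ 2^ 𝒜 ∣
  4p≤∣2^𝒜∣ record { cosets = cs ; 0∷cosets! = 0∷cs! ; 3p≤Σf = 3p≤Σf } =
    ≤-trans (+-mono-≤ f₀ 3p≤Σf) (Σ∣∩fibre∣≤∣∣ (2^ 𝒜) 0∷cs!)

  p≤∣2^A[c]∣ : ∀ {c} → 1 ≤ a c → p + 2 ≤ 2 * a c → p ≤ ∣ 2^ A[ c ] ∣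
  p≤∣2^A[c]∣ {c} 1≤a p+2≤2a = subst (_≤ ∣ 2^ A[ c ] ∣) ∣kernel∣≡p
    (∣kernel∣≤∣2^X∣ 2<p (A[]⊆fibre c) (proj₂ (nonempty {A[ c ]} 1≤a)) (subst (λ t → t + 2 ≤ 2 * a c) (sym ∣kernel∣≡p) p+2≤2a))

  -- one of the two slices is large enough for the restricted pigeonhole, or both satisfy the weak Erdős–Heilbronn bound
  p≤∣2^A[i]∣+∣2^A[j]∣ : ∀ {i j} → 1 ≤ a i → 1 ≤ a j → p < a i + a j → p ≤ ∣ 2^ A[ i ] ∣ + ∣ 2^ A[ j ] ∣
  p≤∣2^A[i]∣+∣2^A[j]∣ {i} {j} 1≤aᵢ 1≤aⱼ p<aᵢ+aⱼ with 3 ≤? a i | 3 ≤? a j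
  ... | yes 3≤aᵢ | yes 3≤aⱼ = both (weakErdősHeilbronn 3≤aᵢ) (weakErdősHeilbronn 3≤aⱼ)
    where
    both : p ≤ ∣ 2^ A[ i ] ∣ ⊎ a i ≤ ∣ 2^ A[ i ] ∣ → p ≤ ∣ 2^ A[ j ] ∣ ⊎ a j ≤ ∣ 2^ A[ j ] ∣ →
           p ≤ ∣ 2^ A[ i ] ∣ + ∣ 2^ A[ j ] ∣
    both (inj₁ p≤) _ = ≤-trans p≤ (m≤m+n _ _)
    both (inj₂ _) (inj₁ p≤) = ≤-trans p≤ (m≤n+m _ _)
    both (inj₂ aᵢ≤) (inj₂ aⱼ≤) = ≤-trans (<⇒≤ p<aᵢ+aⱼ) (+-mono-≤ aᵢ≤ aⱼ≤)
  ... | no aᵢ≱3 | _ =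
    ≤-trans (p≤∣2^A[c]∣ 1≤aⱼ (p+2≤2a₂ p (a i) (a j) p<aᵢ+aⱼ (s≤s⁻¹ (≰⇒> aᵢ≱3)) 4≤p)) (m≤n+m _ _)
  ... | yes _ | no aⱼ≱3 =
    ≤-trans (p≤∣2^A[c]∣ 1≤aᵢ (p+2≤2a₂ p (a j) (a i) (subst (p <_) (+-comm (a i) (a j)) p<aᵢ+aⱼ) (s≤s⁻¹ (≰⇒> aⱼ≱3)) 4≤p))
            (m≤m+n _ _)

  elsewhere-two : ∀ {i j} → Unique (0ₚ ∷ i ∷ j ∷ []) → Estimate (a i) (f i) → Estimate (a j) (f j) →
                  2 * p + 1 ≤ k + (a i + (a j + 0)) → Elsewhere
  elsewhere-two {i} {j} 0ij!@((_ ∷ _ ∷ []) ∷ (i≢j ∷ []) ∷ [] ∷ []) eᵢ eⱼ S = by-sum (i +ₚ j Fin.≟ 0ₚ)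
    where
    p≤fᵢ : p ≤ f i
    p≤fᵢ = saturated eᵢ (p+1≤k+a₁ p k (a i) (a j) S (a≤p eⱼ))

    p≤fⱼ : p ≤ f j
    p≤fⱼ = saturated eⱼ (p+1≤k+a₂ p k (a i) (a j) S (a≤p eᵢ))

    p<aᵢ+aⱼ : p < a i + a j
    p<aᵢ+aⱼ = p<a₁+a₂ p k (a i) (a j) S k≤p

    p≤∣A[i]⊞A[j]∣ : p ≤ ∣ A[ i ] ⊞ A[ j ] ∣
    p≤∣A[i]⊞A[j]∣ = subst (_≤ ∣ A[ i ] ⊞ A[ j ] ∣) ∣kernel∣≡p
      (∣kernel∣≤∣X⊞Y∣ (A[]⊆fibre i) (A[]⊆fibre j) (proj₂ (nonempty {A[ i ]} (1≤a eᵢ))) (proj₂ (nonempty {A[ j ]} (1≤a eⱼ)))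
                     (subst (_< a i + a j) (sym ∣kernel∣≡p) p<aᵢ+aⱼ))

    by-sum : Dec (i +ₚ j ≡ 0ₚ) → Elsewhere
    by-sum (no i+j≢0) = record
      { cosets = i ∷ j ∷ i +ₚ j ∷ []
      ; 0∷cosets! = distinct-with-sum 0ij! i+j≢0
      ; 3p≤Σf = p,p,p⇒3p p (f i) (f j) (f (i +ₚ j)) p≤fᵢ p≤fⱼ (≤-trans p≤∣A[i]⊞A[j]∣ (∣A[i]⊞A[j]∣≤f i≢j))
      }
    by-sum (yes i+j≡0) = record
      { cosets = i ∷ j ∷ i +ₚ i ∷ j +ₚ j ∷ []
      ; 0∷cosets! = distinct-with-doubles 0ij! i+j≡0
      ; 3p≤Σf = p,p,p+⇒3p p (f i) (f j) (f (i +ₚ i)) (f (j +ₚ j)) p≤fᵢ p≤fⱼ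
                  (≤-trans (p≤∣2^A[i]∣+∣2^A[j]∣ (1≤a eᵢ) (1≤a eⱼ) p<aᵢ+aⱼ) (+-mono-≤ (∣2^A[i]∣≤f i) (∣2^A[i]∣≤f j)))
      }

  elsewhere-three : ∀ {i j l} → Unique (0ₚ ∷ i ∷ j ∷ l ∷ []) → All (λ c → Estimate (a c) (f c)) (i ∷ j ∷ l ∷ []) →
                    2 * p + 1 ≤ k + (a i + (a j + (a l + 0))) → Elsewhere
  elsewhere-three {i} {j} {l} 0ijl! estimates S = record
    { cosets = x +ₚ y ∷ x ∷ y ∷ z ∷ []
    ; 0∷cosets! = distinct
    ; 3p≤Σf = three-slices eₓ e_y e_z (≤-trans (∣X∣≤∣X⊞Y∣ (proj₂ (nonempty {A[ y ]} (1≤a e_y)))) ∣A[x]⊞A[y]∣≤f)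
                                      (≤-trans (∣Y∣≤∣X⊞Y∣ (proj₂ (nonempty {A[ x ]} (1≤a eₓ)))) ∣A[x]⊞A[y]∣≤f)
                                      (subst (λ t → 2 * p + 1 ≤ k + t) (sym (sum-↭ (map⁺ a xyz↭ijl))) S)
    }
    where
    open PairSumOutside (pairSumOutside 0ijl!)
    estimates′ : All (λ c → Estimate (a c) (f c)) (x ∷ y ∷ z ∷ [])
    estimates′ = All-resp-↭ (↭-sym xyz↭ijl) estimates
    eₓ : Estimate (a x) (f x)
    eₓ = All.lookup estimates′ (here refl)
    e_y : Estimate (a y) (f y)
    e_y = All.lookup estimates′ (there (here refl))
    e_z : Estimate (a z) (f z)
    e_z = All.lookup estimates′ (there (there (here refl)))
    x≢y : x ≢ y
    x≢y = All.head (AllPairs.head (AllPairs.tail (AllPairs.tail distinct)))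
    ∣A[x]⊞A[y]∣≤f : ∣ A[ x ] ⊞ A[ y ] ∣ ≤ f (x +ₚ y)
    ∣A[x]⊞A[y]∣≤f = ∣A[i]⊞A[j]∣≤f x≢y

  elsewhere : ∀ cs → Unique (0ₚ ∷ cs) → All (λ c → Estimate (a c) (f c)) cs → 2 * p + 1 ≤ k + sum (map a cs) → Elsewhere
  elsewhere [] _ _ S = ⊥-elim (k+a≰2p z≤n S)
  elsewhere (_ ∷ []) _ (e ∷ []) S = ⊥-elim (k+a≰2p (a≤k e) S)
  elsewhere (_ ∷ _ ∷ []) 0∷cs! (eᵢ ∷ eⱼ ∷ []) S = elsewhere-two 0∷cs! eᵢ eⱼ S
  elsewhere (_ ∷ _ ∷ _ ∷ []) 0∷cs! estimates S = elsewhere-three 0∷cs! estimates S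
  elsewhere cs@(_ ∷ _ ∷ _ ∷ _ ∷ rest) 0∷cs! (e₁ ∷ e₂ ∷ e₃ ∷ e₄ ∷ estimates) S = record
    { cosets = cs
    ; 0∷cosets! = 0∷cs!
    ; 3p≤Σf = four-or-more-slices e₁ e₂ e₃ e₄ (sum-map-mono {f = a} {g = f} {xs = rest} (a≤f ∘ All.lookup estimates)) S
    }

  theorem : 4 * p ≤ length (restrictedSumset A)
  theorem = ≤-trans (4p≤∣2^𝒜∣ (elsewhere support 0∷support! support-estimates 2p+1≤k+Σa)) ∣2^𝒜∣≤∣2^A∣

lemma3p11 : (p : ℕ) .{{_ : NonZero p}} → Prime p → 5 ≤ p →
    (A : List (G p)) → Unique A → length A ≡ 2 * p + 1 →
    (H : List (G p)) → Unique H → length H ≡ p →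
    𝟘 ∈ H → (∀ x y → x ∈ H → y ∈ H → x ⊕ y ∈ H) → (∀ x → x ∈ H → ⊖ x ∈ H) →
    (idx : G p → Fin p) →
    (∀ x y → idx (x ⊕ y) ≡ idx x +ₚ idx y) →
    (∀ x → (idx x ≡ 0ₚ) ⇔ (x ∈ H)) →
    (∀ i → length (slice idx A i) ≤ length (slice idx A 0ₚ)) →
    p + 3 ≤ 2 * length (slice idx A 0ₚ) →
    4 * p ≤ length (restrictedSumset A)
lemma3p11 p p-prime 5≤p A A! ∣A∣ H H! ∣H∣ _ _ _ idx idx-homo ker-idx A₀-largest A₀-large =
  Lemma3p11.theorem p p-prime 5≤p A A! ∣A∣ H H! ∣H∣ idx idx-homo ker-idx A₀-largest A₀-large
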